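{- Let $D$ be a bipartite graph with vertex classes $W_1$ and $W_2$, and let $\Delta^+,\Delta^-\geq 1$ be such that every vertex of $W_1$ has degree at most $\Delta^+$ and every vertex of $W_2$ has degree at most $\Delta^-$. Let $a,b\in\mathbb N$ with $a\geq b\geq 32|W_1|$, and let $A$ be a set with $|A|=a$. For each $v\in W_2$ let $\mathcal F_v\subseteq 2^A$ be a family with $|N_D(v)|$-density at most $\frac{1}{4\Delta^+\Delta^- }\big(2^{ -1/2}\frac{b}{a}\big)^{|N_D(v)|}$. Let $f:W_1\to 2^A$ be a function with $|f(u)|\geq b$ for each $u\in W_1$. Then there exists an injective function $\phi:W_1\to A$ such that $\phi(u)\in f(u)$ for every $u\in W_1$ and $\phi(N_D(v))\notin\mathcal F_v$ for every $v\in W_2$.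
   Context: For a set $A$, $1\leq k\leq|A|$ and $\mathcal F\subseteq 2^A$, $\mathcal F$ has $k$-density at most $\delta$ if $|\mathcal F\cap\binom{A}{k}|\leq\delta\binom{|A|}{k}$. $N_D(v)$ denotes the neighbourhood of $v$ in $D$. -}

module Defs where

open import Data.Bool using (Bool; true; false; _∧_)
open import Data.Nat using (ℕ; zero; suc; _+_; _*_; _^_; _≡ᵇ_)
open import Data.Fin using (Fin)
open import Data.Fin.Subset using (Subset; ∣_∣)
open import Data.Fin.Properties using (any?)
open import Data.List using (List; []; _∷_; map; _++_; length; filterᵇ)
open import Data.Vec using (Vec; []; _∷_; tabulate; lookup)
open import Data.Product using (_×_)
open import Relation.Nullary using (does)
open import Relation.Nullary.Decidable using (_×-dec_)
import Data.Bool
open import Relation.Binary.PropositionalEquality using (_≡_)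
open import Data.Fin using (_≟_)

BipGraph : ℕ → ℕ → Set
BipGraph n₁ n₂ = Fin n₁ → Fin n₂ → Bool

N₁ : ∀ {n₁ n₂} → BipGraph n₁ n₂ → Fin n₁ → Subset n₂
N₁ D u = tabulate (λ v → D u v)

N₂ : ∀ {n₁ n₂} → BipGraph n₁ n₂ → Fin n₂ → Subset n₁
N₂ D v = tabulate (λ u → D u v)

allSubsets : (n : ℕ) → List (Subset n)
allSubsets zero = [] ∷ []
allSubsets (suc n) = map (true ∷_) (allSubsets n) ++ map (false ∷_) (allSubsets n)

Family : ℕ → Set
Family a = Subset a → Bool

levelCount : ∀ {a} → Family a → ℕ → ℕ
levelCount {a} 𝓕 k = length (filterᵇ (λ s → (∣ s ∣ ≡ᵇ k) ∧ 𝓕 s) (allSubsets a))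

binom : ℕ → ℕ → ℕ
binom n zero = 1
binom zero (suc k) = 0
binom (suc n) (suc k) = binom n k + binom n (suc k)

-- 𝓕 has k-density at most  (1/(4 Δ⁺ Δ⁻)) (2^{-1/2} b/a)^k,  i.e.
--   |𝓕 ∩ binom(A,k)| ≤ (1/(4Δ⁺Δ⁻)) (2^{-1/2} b/a)^k · binom(a,k).
-- Both sides are nonnegative, so this is equivalent (for a ≥ 1) to the squared,
-- denominator-cleared inequality over ℕ:
--   |𝓕 ∩ binom(A,k)|² · 16 (Δ⁺Δ⁻)² · a^(2k) · 2^k ≤ binom(a,k)² · b^(2k).
DensityBound : ∀ {a} → (Δ⁺ Δ⁻ b k : ℕ) → Family a → Set
DensityBound {a} Δ⁺ Δ⁻ b k 𝓕 =
  let c = levelCount 𝓕 k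
      d = Δ⁺ * Δ⁻
  in c * c * (16 * (d * d)) * (a ^ (2 * k)) * (2 ^ k) Data.Nat.≤ binom a k * binom a k * (b ^ (2 * k))

image : ∀ {m a} → (Fin m → Fin a) → Subset m → Subset a
image φ S = tabulate (λ x → does (any? (λ u → (lookup S u Data.Bool.≟ true) ×-dec (φ u ≟ x))))

-- Fix, for every u ∈ W₁, an injection e u : Fin b → f u and put φ u = e u (ω u) for ω uniform in
-- Vec (Fin b) |W₁|, so that probabilities are counts divided by b ^ |W₁|. The bad events are a
-- collision φ u = φ w for each pair u < w, of probability at most 1/b, and, for each v ∈ W₂, the
-- spoiling event that φ is injective on N(v) with φ(N(v)) ∈ 𝓕 v, of probability at most
-- |𝓕 v ∩ (A choose k)| k! / b^k ≤ (3/4)^k / (4Δ⁺Δ⁻) for k = |N(v)| by the density hypothesis.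
-- Each event is determined by the coordinates in its support; a spoiling event shares coordinates
-- with at most Δ⁺Δ⁻ spoiling and k|W₁| collision events, a collision event with at most 2Δ⁺ and
-- 2|W₁|. The asymmetric local lemma with weights 1/(2Δ⁺Δ⁻) and 8/b, whose side conditions follow
-- from b ≥ 32|W₁| and Bernoulli's inequality, leaves an ω avoiding every bad event.

module Submission where

open import Data.Bool using (Bool; true; false; _∧_; _∨_; not; T)
import Data.Bool as Bool
open import Data.Bool.Properties using (not-involutive; ∧-assoc; ∧-zeroʳ; ∨-zeroʳ; T-∧)
open import Data.Bool.ListAction using (all)
open import Data.Nat
  using (ℕ; zero; suc; pred; _+_; _*_; _∸_; _^_; _!; _≤_; _<_; _≤?_; _≡ᵇ_; z≤n; s≤s; NonZero; >-nonZero; >-nonZero⁻¹)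
open import Data.Nat.Properties hiding (_≟_; _<?_)
open import Data.Nat.ListAction using (product)
open import Data.Nat.ListAction.Properties using (product-++; product-↭)
open import Data.Nat.Tactic.RingSolver using (solve-∀)
open import Data.Fin using (Fin; zero; suc; _≟_; _<?_)
import Data.Fin as Fin
open import Data.Fin.Properties using (any?; all?)
import Data.Fin.Properties as FinP
open import Data.Fin.Subset using (Subset; ∣_∣; _∈_; _-_)
open import Data.Fin.Subset.Properties using (x∈p∧x≢y⇒x∈p-y; x∈p⇒∣p-x∣<∣p∣)
open import Data.Vec using (Vec; []; _∷_; lookup; _[_]≔_)
open import Data.Vec.Properties
  using (lookup∘tabulate; tabulate-cong; lookup⇒[]=; []=⇒lookup; lookup∘update; lookup∘update′)
open import Data.List using (List; []; _∷_; _++_; map; length; filterᵇ; allFin; cartesianProduct)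
import Data.List as List
open import Data.List.Properties using (map-++; filter-++; length-++; ++-identityʳ)
open import Data.List.Membership.Propositional using () renaming (_∈_ to _∈ˡ_)
open import Data.List.Membership.Propositional.Properties
  using ( ∈-∃++; ∈-++⁻; ∈-++⁺ˡ; ∈-++⁺ʳ; ∈-map⁺; ∈-map⁻; ∈-filter⁺; ∈-filter⁻; ∈-lookup; ∈-allFin
        ; ∈-cartesianProduct⁺)
open import Data.List.Relation.Binary.Subset.Propositional using (_⊆_)
open import Data.List.Relation.Binary.Permutation.Propositional.Properties using (shift; map⁺)
import Data.List.Relation.Unary.All as All
open import Data.List.Relation.Unary.Any using (here; there; index)
open import Data.List.Relation.Unary.Any.Properties using (lookup-index)
open import Data.List.Relation.Unary.Unique.Propositional using (Unique; _∷_)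
import Data.List.Relation.Unary.Unique.Propositional.Properties as Unique
open import Data.Product using (Σ; ∃; _×_; _,_; proj₁; proj₂)
open import Data.Sum using (_⊎_; inj₁; inj₂)
open import Data.Sum.Properties using (inj₁-injective; inj₂-injective)
open import Data.Empty using (⊥)
open import Function using (_∘_; mk⇔; Equivalence)
open import Function.Definitions using (Injective)
open import Relation.Binary.Definitions using (tri<; tri≈; tri>)
open import Relation.Binary.PropositionalEquality
open import Relation.Nullary using (Dec; yes; no; does; contradiction)
open import Relation.Nullary.Decidable using (T?; _×-dec_; _→-dec_; dec-true; does-⇔)
open import Algebra.Properties.Semiring.Sum +-*-semiring
  using (sum; sum-syntax; sum-cong-≗; ∑-distrib-+; ∑-comm; *-distribˡ-sum; *-distribʳ-sum)
open import Defs

⟦_⟧ : Bool → ℕ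
⟦ true ⟧ = 1
⟦ false ⟧ = 0

⟦∧⟧ : ∀ s t → ⟦ s ∧ t ⟧ ≡ ⟦ s ⟧ * ⟦ t ⟧
⟦∧⟧ true t = sym (+-identityʳ ⟦ t ⟧)
⟦∧⟧ false t = refl

⟦∨⟧≤ : ∀ s t → ⟦ s ∨ t ⟧ ≤ ⟦ s ⟧ + ⟦ t ⟧
⟦∨⟧≤ true t = s≤s z≤n
⟦∨⟧≤ false t = ≤-refl

⟦⟧-split : ∀ s t → ⟦ t ⟧ ≡ ⟦ s ∧ t ⟧ + ⟦ not s ∧ t ⟧
⟦⟧-split true t = sym (+-identityʳ ⟦ t ⟧)
⟦⟧-split false t = refl

⟦⟧>0⇒≡true : ∀ {t} → 0 < ⟦ t ⟧ → t ≡ true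
⟦⟧>0⇒≡true {true} _ = refl

⟦s∧[t∨u]⟧≤⟦t⟧+⟦u⟧ : ∀ s t u → ⟦ s ∧ (t ∨ u) ⟧ ≤ ⟦ t ⟧ + ⟦ u ⟧
⟦s∧[t∨u]⟧≤⟦t⟧+⟦u⟧ false t u = z≤n
⟦s∧[t∨u]⟧≤⟦t⟧+⟦u⟧ true t u = ⟦∨⟧≤ t u

⟦s∧[t∨u]⟧≤⟦s⟧*⟦t⟧+⟦s⟧*⟦u⟧ : ∀ s t u →
  ⟦ s ∧ (t ∨ u) ⟧ ≤ ⟦ s ⟧ * ⟦ t ⟧ + ⟦ s ⟧ * ⟦ u ⟧
⟦s∧[t∨u]⟧≤⟦s⟧*⟦t⟧+⟦s⟧*⟦u⟧ false t u = z≤n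
⟦s∧[t∨u]⟧≤⟦s⟧*⟦t⟧+⟦s⟧*⟦u⟧ true true u = s≤s z≤n
⟦s∧[t∨u]⟧≤⟦s⟧*⟦t⟧+⟦s⟧*⟦u⟧ true false true = s≤s z≤n
⟦s∧[t∨u]⟧≤⟦s⟧*⟦t⟧+⟦s⟧*⟦u⟧ true false false = z≤n

∑-mono-≤ : ∀ {n} {f g : Fin n → ℕ} → (∀ i → f i ≤ g i) → sum f ≤ sum g
∑-mono-≤ {zero} f≤g = z≤n
∑-mono-≤ {suc n} f≤g = +-mono-≤ (f≤g zero) (∑-mono-≤ (λ i → f≤g (suc i)))

∑-const : ∀ n c → ∑[ i < n ] c ≡ n * c
∑-const zero c = refl
∑-const (suc n) c = cong (c +_) (∑-const n c)

term≤∑ : ∀ {n} (f : Fin n → ℕ) i → f i ≤ sum f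
term≤∑ f zero = m≤m+n (f zero) _
term≤∑ f (suc i) = ≤-trans (term≤∑ (λ j → f (suc j)) i) (m≤n+m _ (f zero))

∑-zero : ∀ {n} {f : Fin n → ℕ} → (∀ i → f i ≡ 0) → sum f ≡ 0
∑-zero {zero} f≡0 = refl
∑-zero {suc n} f≡0 = cong₂ _+_ (f≡0 zero) (∑-zero (λ i → f≡0 (suc i)))

∑>0⇒term>0 : ∀ {n} (f : Fin n → ℕ) → 0 < sum f → Σ (Fin n) (λ i → 0 < f i)
∑>0⇒term>0 {suc n} f ∑f>0 with f zero in eq
... | suc _ = zero , subst (0 <_) (sym eq) (s≤s z≤n)
... | zero with ∑>0⇒term>0 (λ i → f (suc i)) ∑f>0
...   | i , fi>0 = suc i , fi>0

∑⟦⟧≤1 : ∀ {n} (P : Fin n → Bool) → (∀ i j → P i ≡ true → P j ≡ true → i ≡ j) → ∑[ i < n ] ⟦ P i ⟧ ≤ 1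
∑⟦⟧≤1 {zero} P unique = z≤n
∑⟦⟧≤1 {suc n} P unique with P zero in eq
... | false = ∑⟦⟧≤1 (λ i → P (suc i)) (λ i j pi pj → FinP.suc-injective (unique (suc i) (suc j) pi pj))
... | true = s≤s (≤-reflexive (∑-zero (λ i → cong ⟦_⟧ (others i))))
  where
  others : ∀ i → P (suc i) ≡ false
  others i with P (suc i) in eqᵢ
  ... | false = refl
  ... | true with () ← unique zero (suc i) eq eqᵢ

∑-δ : ∀ {n} (y : Fin n) (h : Fin n → ℕ) → ∑[ x < n ] (⟦ does (y ≟ x) ⟧ * h x) ≡ h y
∑-δ {suc n} zero h = trans (cong₂ _+_ (+-identityʳ (h zero)) (∑-zero {n} (λ _ → refl))) (+-identityʳ (h zero))
∑-δ {suc n} (suc y) h = ∑-δ y (h ∘ suc)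

∑∘injective≤∑ : ∀ {k m} (e : Fin k → Fin m) → Injective _≡_ _≡_ e → (h : Fin m → ℕ) →
  ∑[ c < k ] h (e c) ≤ ∑[ x < m ] h x
∑∘injective≤∑ {k} {m} e e-inj h = begin
  ∑[ c < k ] h (e c)
    ≡⟨ sum-cong-≗ (λ c → ∑-δ (e c) h) ⟨
  ∑[ c < k ] ∑[ x < m ] (⟦ does (e c ≟ x) ⟧ * h x)
    ≡⟨ ∑-comm (λ c x → ⟦ does (e c ≟ x) ⟧ * h x) ⟩
  ∑[ x < m ] ∑[ c < k ] (⟦ does (e c ≟ x) ⟧ * h x)
    ≡⟨ sum-cong-≗ (λ x → *-distribʳ-sum (h x) (λ c → ⟦ does (e c ≟ x) ⟧)) ⟨
  ∑[ x < m ] ((∑[ c < k ] ⟦ does (e c ≟ x) ⟧) * h x)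
    ≤⟨ ∑-mono-≤ (λ x → *-monoˡ-≤ (h x) (∑⟦⟧≤1 _ (preimage-unique x))) ⟩
  ∑[ x < m ] (1 * h x)
    ≡⟨ sum-cong-≗ (λ x → *-identityˡ (h x)) ⟩
  ∑[ x < m ] h x ∎
  where
  open ≤-Reasoning
  preimage-unique : ∀ x c c′ → does (e c ≟ x) ≡ true → does (e c′ ≟ x) ≡ true → c ≡ c′
  preimage-unique x c c′ ec≡x ec′≡x with e c ≟ x | e c′ ≟ x
  ... | yes ec≡x | yes ec′≡x = e-inj (trans ec≡x (sym ec′≡x))

∑-indicator≡1 : ∀ {n} (y : Fin n) → ∑[ x < n ] ⟦ does (x ≟ y) ⟧ ≡ 1
∑-indicator≡1 {n} y = begin
  ∑[ x < n ] ⟦ does (x ≟ y) ⟧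
    ≡⟨ sum-cong-≗ (λ x → cong ⟦_⟧ (does-⇔ (mk⇔ sym sym) (x ≟ y) (y ≟ x))) ⟩
  ∑[ x < n ] ⟦ does (y ≟ x) ⟧
    ≡⟨ sum-cong-≗ (λ x → *-identityʳ ⟦ does (y ≟ x) ⟧) ⟨
  ∑[ x < n ] (⟦ does (y ≟ x) ⟧ * 1)
    ≡⟨ ∑-δ y (λ _ → 1) ⟩
  1 ∎
  where open ≡-Reasoning

⟦<⟧+⟦>⟧≤1 : ∀ {n} (u w : Fin n) → ⟦ does (u <? w) ⟧ + ⟦ does (w <? u) ⟧ ≤ 1
⟦<⟧+⟦>⟧≤1 u w = exclusive (u <? w) (w <? u)
  where
  exclusive : (u<?w : Dec (u Fin.< w)) (w<?u : Dec (w Fin.< u)) → ⟦ does u<?w ⟧ + ⟦ does w<?u ⟧ ≤ 1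
  exclusive (yes u<w) (yes w<u) = contradiction w<u (FinP.<-asym u<w)
  exclusive (yes _) (no _) = ≤-refl
  exclusive (no _) (yes _) = ≤-refl
  exclusive (no _) (no _) = z≤n

∑∑-ordered-pairs-through≤ : ∀ {n} (z : Fin n) →
  ∑[ u < n ] ∑[ w < n ] ⟦ does (u <? w) ∧ (does (z ≟ u) ∨ does (z ≟ w)) ⟧ ≤ n
∑∑-ordered-pairs-through≤ {n} z = begin
  ∑[ u < n ] ∑[ w < n ] ⟦ does (u <? w) ∧ (does (z ≟ u) ∨ does (z ≟ w)) ⟧
    ≤⟨ ∑-mono-≤ (λ u → ∑-mono-≤ (λ w →
         ⟦s∧[t∨u]⟧≤⟦s⟧*⟦t⟧+⟦s⟧*⟦u⟧ (does (u <? w)) (does (z ≟ u)) (does (z ≟ w)))) ⟩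
  ∑[ u < n ] ∑[ w < n ] (L u w * ⟦ does (z ≟ u) ⟧ + L u w * ⟦ does (z ≟ w) ⟧)
    ≡⟨ trans (sum-cong-≗ (λ u → ∑-distrib-+ (λ w → L u w * ⟦ does (z ≟ u) ⟧) (λ w → L u w * ⟦ does (z ≟ w) ⟧)))
             (∑-distrib-+ (λ u → ∑[ w < n ] (L u w * ⟦ does (z ≟ u) ⟧))
                          (λ u → ∑[ w < n ] (L u w * ⟦ does (z ≟ w) ⟧))) ⟩
  ∑[ u < n ] ∑[ w < n ] (L u w * ⟦ does (z ≟ u) ⟧) + ∑[ u < n ] ∑[ w < n ] (L u w * ⟦ does (z ≟ w) ⟧)
    ≡⟨ cong₂ _+_ (trans (sum-cong-≗ (λ u → pull (λ w → L u w) (does (z ≟ u))))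
                        (∑-δ z (λ u → ∑[ w < n ] L u w)))
                 (trans (∑-comm (λ u w → L u w * ⟦ does (z ≟ w) ⟧))
                        (trans (sum-cong-≗ (λ w → pull (λ u → L u w) (does (z ≟ w))))
                               (∑-δ z (λ w → ∑[ u < n ] L u w)))) ⟩
  ∑[ w < n ] L z w + ∑[ u < n ] L u z
    ≡⟨ ∑-distrib-+ (L z) (λ w → L w z) ⟨
  ∑[ w < n ] (L z w + L w z)
    ≤⟨ ∑-mono-≤ (⟦<⟧+⟦>⟧≤1 z) ⟩
  ∑[ w < n ] 1
    ≡⟨ trans (∑-const n 1) (*-identityʳ n) ⟩
  n ∎
  where
  open ≤-Reasoning
  L : Fin n → Fin n → ℕ
  L u w = ⟦ does (u <? w) ⟧
  pull : ∀ (h : Fin n → ℕ) t → ∑[ w < n ] (h w * ⟦ t ⟧) ≡ ⟦ t ⟧ * ∑[ w < n ] h w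
  pull h t = trans (sym (*-distribʳ-sum ⟦ t ⟧ h)) (*-comm (∑[ w < n ] h w) ⟦ t ⟧)

∑∑-weighted-swap : ∀ {m n} (U : Fin n → Bool) (h : Fin m → Fin n → ℕ) →
  ∑[ j < m ] ∑[ z < n ] (⟦ U z ⟧ * h j z) ≡ ∑[ z < n ] (⟦ U z ⟧ * ∑[ j < m ] h j z)
∑∑-weighted-swap U h =
  trans (∑-comm (λ j z → ⟦ U z ⟧ * h j z)) (sum-cong-≗ (λ z → sym (*-distribˡ-sum ⟦ U z ⟧ (λ j → h j z))))

∑-weighted≤ : ∀ {n δ} (U : Fin n → Bool) {H : Fin n → ℕ} → (∀ z → H z ≤ δ) →
  ∑[ z < n ] (⟦ U z ⟧ * H z) ≤ ∑[ z < n ] ⟦ U z ⟧ * δ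
∑-weighted≤ {n} {δ} U H≤δ =
  ≤-trans (∑-mono-≤ (λ z → *-monoʳ-≤ ⟦ U z ⟧ (H≤δ z))) (≤-reflexive (sym (*-distribʳ-sum δ (λ z → ⟦ U z ⟧))))

-- Counting in the product space Vec (Fin b) n

module _ {b : ℕ} where

  ∑Ω : ∀ n → (Vec (Fin b) n → ℕ) → ℕ
  ∑Ω zero f = f []
  ∑Ω (suc n) f = ∑[ c < b ] ∑Ω n (λ ω → f (c ∷ ω))

  count : ∀ n → (Vec (Fin b) n → Bool) → ℕ
  count n P = ∑Ω n (λ ω → ⟦ P ω ⟧)

  ∑Ω-cong : ∀ n {f g : Vec (Fin b) n → ℕ} → (∀ ω → f ω ≡ g ω) → ∑Ω n f ≡ ∑Ω n g
  ∑Ω-cong zero f≡g = f≡g []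
  ∑Ω-cong (suc n) f≡g = sum-cong-≗ (λ c → ∑Ω-cong n (λ ω → f≡g (c ∷ ω)))

  ∑Ω-mono-≤ : ∀ n {f g : Vec (Fin b) n → ℕ} → (∀ ω → f ω ≤ g ω) → ∑Ω n f ≤ ∑Ω n g
  ∑Ω-mono-≤ zero f≤g = f≤g []
  ∑Ω-mono-≤ (suc n) f≤g = ∑-mono-≤ (λ c → ∑Ω-mono-≤ n (λ ω → f≤g (c ∷ ω)))

  ∑Ω-distrib-+ : ∀ n (f g : Vec (Fin b) n → ℕ) → ∑Ω n (λ ω → f ω + g ω) ≡ ∑Ω n f + ∑Ω n g
  ∑Ω-distrib-+ zero f g = refl
  ∑Ω-distrib-+ (suc n) f g =
    trans (sum-cong-≗ (λ c → ∑Ω-distrib-+ n (λ ω → f (c ∷ ω)) (λ ω → g (c ∷ ω))))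
          (∑-distrib-+ (λ c → ∑Ω n (λ ω → f (c ∷ ω))) (λ c → ∑Ω n (λ ω → g (c ∷ ω))))

  *-distribˡ-∑Ω : ∀ n x (f : Vec (Fin b) n → ℕ) → x * ∑Ω n f ≡ ∑Ω n (λ ω → x * f ω)
  *-distribˡ-∑Ω zero x f = refl
  *-distribˡ-∑Ω (suc n) x f =
    trans (*-distribˡ-sum x (λ c → ∑Ω n (λ ω → f (c ∷ ω))))
          (sum-cong-≗ (λ c → *-distribˡ-∑Ω n x (λ ω → f (c ∷ ω))))

  ∑Ω-const : ∀ n x → ∑Ω n (λ _ → x) ≡ x * b ^ n
  ∑Ω-const zero x = sym (*-identityʳ x)
  ∑Ω-const (suc n) x = begin
    ∑[ c < b ] ∑Ω n (λ _ → x)  ≡⟨ sum-cong-≗ {b} (λ c → ∑Ω-const n x) ⟩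
    ∑[ c < b ] (x * b ^ n)     ≡⟨ ∑-const b (x * b ^ n) ⟩
    b * (x * b ^ n)            ≡⟨ x*[y*z]≡y*[x*z] b x (b ^ n) ⟩
    x * (b * b ^ n)            ∎
    where
    open ≡-Reasoning
    x*[y*z]≡y*[x*z] : ∀ x y z → x * (y * z) ≡ y * (x * z)
    x*[y*z]≡y*[x*z] = solve-∀

  ∑Ω-comm-∑ : ∀ n {m} (f : Fin m → Vec (Fin b) n → ℕ) →
    ∑Ω n (λ ω → ∑[ i < m ] f i ω) ≡ ∑[ i < m ] ∑Ω n (f i)
  ∑Ω-comm-∑ zero f = refl
  ∑Ω-comm-∑ (suc n) f =
    trans (sum-cong-≗ (λ c → ∑Ω-comm-∑ n (λ i ω → f i (c ∷ ω)))) (∑-comm (λ c i → ∑Ω n (λ ω → f i (c ∷ ω))))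

  ∑Ω>0⇒term>0 : ∀ n (f : Vec (Fin b) n → ℕ) → 0 < ∑Ω n f → Σ (Vec (Fin b) n) (λ ω → 0 < f ω)
  ∑Ω>0⇒term>0 zero f f[]>0 = [] , f[]>0
  ∑Ω>0⇒term>0 (suc n) f ∑f>0 with ∑>0⇒term>0 (λ c → ∑Ω n (λ ω → f (c ∷ ω))) ∑f>0
  ... | c , ∑fc>0 with ∑Ω>0⇒term>0 n (λ ω → f (c ∷ ω)) ∑fc>0
  ...   | ω , fω>0 = c ∷ ω , fω>0

  _≈[_]_ : ∀ {n} → Vec (Fin b) n → (Fin n → Bool) → Vec (Fin b) n → Set
  ω ≈[ V ] ω′ = ∀ z → V z ≡ true → lookup ω z ≡ lookup ω′ z

  DependsOn : ∀ {n} {A : Set} → (Fin n → Bool) → (Vec (Fin b) n → A) → Set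
  DependsOn V f = ∀ ω ω′ → ω ≈[ V ] ω′ → f ω ≡ f ω′

  DependsOn-tail : ∀ {n A} {V : Fin (suc n) → Bool} {f : Vec (Fin b) (suc n) → A} →
    DependsOn V f → ∀ c → DependsOn (V ∘ suc) (λ ω → f (c ∷ ω))
  DependsOn-tail df c ω ω′ ω≈ω′ = df (c ∷ ω) (c ∷ ω′) agree
    where
    agree : (c ∷ ω) ≈[ _ ] (c ∷ ω′)
    agree zero _ = refl
    agree (suc z) Vz = ω≈ω′ z Vz

  DependsOn-head : ∀ {n A} {V : Fin (suc n) → Bool} {f : Vec (Fin b) (suc n) → A} →
    V zero ≡ false → DependsOn V f → ∀ c c′ ω → f (c ∷ ω) ≡ f (c′ ∷ ω)
  DependsOn-head {V = V} V₀≡false df c c′ ω = df (c ∷ ω) (c′ ∷ ω) agree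
    where
    agree : (c ∷ ω) ≈[ V ] (c′ ∷ ω)
    agree zero V₀≡true with () ← trans (sym V₀≡false) V₀≡true
    agree (suc z) _ = refl

  DependsOn-not-not : ∀ {n A} {V : Fin n → Bool} {f : Vec (Fin b) n → A} →
    DependsOn V f → DependsOn (not ∘ not ∘ V) f
  DependsOn-not-not {V = V} df ω ω′ ω≈ω′ = df ω ω′ (λ z Vz → ω≈ω′ z (trans (not-involutive (V z)) Vz))

  private
    ∑Ω-independent-step : ∀ n {f g : Vec (Fin b) (suc n) → ℕ} →
      (∀ c c′ ω → g (c ∷ ω) ≡ g (c′ ∷ ω)) →
      (∀ c → ∑Ω n (λ ω → f (c ∷ ω) * g (c ∷ ω)) * b ^ n ≡
             ∑Ω n (λ ω → f (c ∷ ω)) * ∑Ω n (λ ω → g (c ∷ ω))) →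
      ∑Ω (suc n) (λ ω → f ω * g ω) * b ^ suc n ≡ ∑Ω (suc n) f * ∑Ω (suc n) g
    ∑Ω-independent-step n {f} {g} g-ignores-head tails = begin
      (∑[ c < b ] H c) * (b * b ^ n)      ≡⟨ x*[y*z]≡y*[x*z] (∑[ c < b ] H c) b (b ^ n) ⟩
      b * ((∑[ c < b ] H c) * b ^ n)      ≡⟨ cong (b *_) (*-distribʳ-sum (b ^ n) H) ⟩
      b * (∑[ c < b ] (H c * b ^ n))      ≡⟨ cong (b *_) (sum-cong-≗ tails) ⟩
      b * (∑[ c < b ] (F c * G c))        ≡⟨ *-distribˡ-sum b (λ c → F c * G c) ⟩
      ∑[ c < b ] (b * (F c * G c))        ≡⟨ sum-cong-≗ (λ c → x*[y*z]≡y*[x*z] b (F c) (G c)) ⟩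
      ∑[ c < b ] (F c * (b * G c))        ≡⟨ sum-cong-≗ (λ c → cong (F c *_) (∑G≡b*G c)) ⟨
      ∑[ c < b ] (F c * (∑[ c′ < b ] G c′)) ≡⟨ *-distribʳ-sum (∑[ c′ < b ] G c′) F ⟨
      (∑[ c < b ] F c) * (∑[ c < b ] G c) ∎
      where
      open ≡-Reasoning
      F G H : Fin b → ℕ
      F c = ∑Ω n (λ ω → f (c ∷ ω))
      G c = ∑Ω n (λ ω → g (c ∷ ω))
      H c = ∑Ω n (λ ω → f (c ∷ ω) * g (c ∷ ω))
      x*[y*z]≡y*[x*z] : ∀ x y z → x * (y * z) ≡ y * (x * z)
      x*[y*z]≡y*[x*z] = solve-∀
      ∑G≡b*G : ∀ c → ∑[ c′ < b ] G c′ ≡ b * G c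
      ∑G≡b*G c = trans (sum-cong-≗ (λ c′ → ∑Ω-cong n (g-ignores-head c′ c))) (∑-const b (G c))

  ∑Ω-independent : ∀ n (V : Fin n → Bool) {f g : Vec (Fin b) n → ℕ} →
    DependsOn V f → DependsOn (not ∘ V) g →
    ∑Ω n (λ ω → f ω * g ω) * b ^ n ≡ ∑Ω n f * ∑Ω n g
  ∑Ω-independent zero V df dg = *-identityʳ _
  ∑Ω-independent (suc n) V {f} {g} df dg with V zero in V₀
  ... | true = ∑Ω-independent-step n {f} {g} (DependsOn-head (cong not V₀) dg)
                 (λ c → ∑Ω-independent n (V ∘ suc) (DependsOn-tail {f = f} df c) (DependsOn-tail {f = g} dg c))
  ... | false = begin
      ∑Ω (suc n) (λ ω → f ω * g ω) * b ^ suc n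
        ≡⟨ cong (_* b ^ suc n) (∑Ω-cong (suc n) (λ ω → *-comm (f ω) (g ω))) ⟩
      ∑Ω (suc n) (λ ω → g ω * f ω) * b ^ suc n
        ≡⟨ ∑Ω-independent-step n {g} {f} (DependsOn-head V₀ df)
             (λ c → ∑Ω-independent n (not ∘ V ∘ suc) (DependsOn-tail {f = g} dg c)
                      (DependsOn-tail {f = f} (DependsOn-not-not df) c)) ⟩
      ∑Ω (suc n) g * ∑Ω (suc n) f
        ≡⟨ *-comm (∑Ω (suc n) g) (∑Ω (suc n) f) ⟩
      ∑Ω (suc n) f * ∑Ω (suc n) g ∎
    where open ≡-Reasoning

  count*b≤b^n : ∀ {n} (w : Fin n) (P : Vec (Fin b) n → Bool) →
    (∀ ω c c′ → P (ω [ w ]≔ c) ≡ true → P (ω [ w ]≔ c′) ≡ true → c ≡ c′) →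
    count n P * b ≤ b ^ n
  count*b≤b^n {suc n} zero P unique = begin
    count (suc n) P * b
      ≡⟨ cong (_* b) (∑Ω-comm-∑ n (λ c ω → ⟦ P (c ∷ ω) ⟧)) ⟨
    ∑Ω n (λ ω → ∑[ c < b ] ⟦ P (c ∷ ω) ⟧) * b
      ≤⟨ *-monoˡ-≤ b (∑Ω-mono-≤ n (λ ω → ∑⟦⟧≤1 _ (λ c c′ → unique (c ∷ ω) c c′))) ⟩
    ∑Ω n (λ _ → 1) * b
      ≡⟨ cong (_* b) (trans (∑Ω-const n 1) (*-identityˡ (b ^ n))) ⟩
    b ^ n * b
      ≡⟨ *-comm (b ^ n) b ⟩
    b ^ suc n ∎
    where open ≤-Reasoning
  count*b≤b^n {suc n} (suc w) P unique = begin
    (∑[ c < b ] count n (λ ω → P (c ∷ ω))) * b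
      ≡⟨ *-distribʳ-sum b (λ c → count n (λ ω → P (c ∷ ω))) ⟩
    ∑[ c < b ] (count n (λ ω → P (c ∷ ω)) * b)
      ≤⟨ ∑-mono-≤ (λ c → count*b≤b^n w (λ ω → P (c ∷ ω)) (λ ω → unique (c ∷ ω))) ⟩
    ∑[ c < b ] (b ^ n)
      ≡⟨ ∑-const b (b ^ n) ⟩
    b * b ^ n ∎
    where open ≤-Reasoning

module _ {X : Set} where

  ∏ : (X → ℕ) → List X → ℕ
  ∏ f xs = product (map f xs)

  ∏-++ : ∀ (f : X → ℕ) xs ys → ∏ f (xs ++ ys) ≡ ∏ f xs * ∏ f ys
  ∏-++ f xs ys = trans (cong product (map-++ f xs ys)) (product-++ (map f xs) (map f ys))

  ∏-shift : ∀ (f : X → ℕ) x xs ys → ∏ f (xs ++ x ∷ ys) ≡ f x * ∏ f (xs ++ ys)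
  ∏-shift f x xs ys = product-↭ (map⁺ f (shift x xs ys))

  ∏-mono-≤ : ∀ {f g : X → ℕ} → (∀ x → f x ≤ g x) → ∀ xs → ∏ f xs ≤ ∏ g xs
  ∏-mono-≤ f≤g [] = ≤-refl
  ∏-mono-≤ f≤g (x ∷ xs) = *-mono-≤ (f≤g x) (∏-mono-≤ f≤g xs)

  ∏>0 : ∀ {f : X → ℕ} → (∀ x → 0 < f x) → ∀ xs → 0 < ∏ f xs
  ∏>0 f>0 [] = s≤s z≤n
  ∏>0 f>0 (x ∷ xs) = *-mono-≤ (f>0 x) (∏>0 f>0 xs)

  ∏-⊆ : ∀ {r q : X → ℕ} → (∀ x → r x ≤ q x) →
    ∀ S T → Unique S → S ⊆ T → ∏ r T * ∏ q S ≤ ∏ r S * ∏ q T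
  ∏-⊆ {r} {q} r≤q [] T _ _ = begin
    ∏ r T * 1  ≡⟨ *-identityʳ (∏ r T) ⟩
    ∏ r T      ≤⟨ ∏-mono-≤ r≤q T ⟩
    ∏ q T      ≡⟨ *-identityˡ (∏ q T) ⟨
    1 * ∏ q T  ∎
    where open ≤-Reasoning
  ∏-⊆ {r} {q} r≤q (x ∷ S) T (x∉S ∷ S!) S⊆T with xs , ys , refl ← ∈-∃++ (S⊆T (here refl)) = begin
    ∏ r (xs ++ x ∷ ys) * (q x * ∏ q S)        ≡⟨ cong (_* (q x * ∏ q S)) (∏-shift r x xs ys) ⟩
    (r x * ∏ r (xs ++ ys)) * (q x * ∏ q S)    ≡⟨ swap-middle (r x) (∏ r (xs ++ ys)) (q x) (∏ q S) ⟩
    (r x * q x) * (∏ r (xs ++ ys) * ∏ q S)    ≤⟨ *-monoʳ-≤ (r x * q x) (∏-⊆ r≤q S (xs ++ ys) S! S⊆xs++ys) ⟩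
    (r x * q x) * (∏ r S * ∏ q (xs ++ ys))    ≡⟨ swap-middle (r x) (q x) (∏ r S) (∏ q (xs ++ ys)) ⟩
    (r x * ∏ r S) * (q x * ∏ q (xs ++ ys))    ≡⟨ cong (r x * ∏ r S *_) (∏-shift q x xs ys) ⟨
    ∏ r (x ∷ S) * ∏ q (xs ++ x ∷ ys)          ∎
    where
    open ≤-Reasoning
    swap-middle : ∀ a b c d → (a * b) * (c * d) ≡ (a * c) * (b * d)
    swap-middle = solve-∀
    S⊆xs++ys : S ⊆ xs ++ ys
    S⊆xs++ys {y} y∈S with ∈-++⁻ xs (S⊆T (there y∈S))
    ... | inj₁ y∈xs = ∈-++⁺ˡ y∈xs
    ... | inj₂ (here refl) = contradiction refl (All.lookup x∉S y∈S)
    ... | inj₂ (there y∈ys) = ∈-++⁺ʳ xs y∈ys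

meets : ∀ {n} → (Fin n → Bool) → (Fin n → Bool) → Bool
meets {zero} U W = false
meets {suc n} U W = (U zero ∧ W zero) ∨ meets (U ∘ suc) (W ∘ suc)

meets≡false : ∀ {n} (U W : Fin n → Bool) → meets U W ≡ false → ∀ z → W z ≡ true → U z ≡ false
meets≡false U W disjoint zero W₀ with U zero | W zero
... | false | _ = refl
... | true | true with () ← disjoint
meets≡false U W disjoint (suc z) W₀ with U zero ∧ W zero
... | false = meets≡false (U ∘ suc) (W ∘ suc) disjoint z W₀

⟦meets⟧≤∑ : ∀ {n} (U W : Fin n → Bool) → ⟦ meets U W ⟧ ≤ ∑[ z < n ] (⟦ U z ⟧ * ⟦ W z ⟧)
⟦meets⟧≤∑ {zero} U W = z≤n
⟦meets⟧≤∑ {suc n} U W = begin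
  ⟦ (U zero ∧ W zero) ∨ meets (U ∘ suc) (W ∘ suc) ⟧    ≤⟨ ⟦∨⟧≤ (U zero ∧ W zero) _ ⟩
  ⟦ U zero ∧ W zero ⟧ + ⟦ meets (U ∘ suc) (W ∘ suc) ⟧  ≤⟨ +-mono-≤ (≤-reflexive (⟦∧⟧ (U zero) (W zero)))
                                                                     (⟦meets⟧≤∑ (U ∘ suc) (W ∘ suc)) ⟩
  ⟦ U zero ⟧ * ⟦ W zero ⟧ + ∑[ z < n ] (⟦ U (suc z) ⟧ * ⟦ W (suc z) ⟧) ∎
  where open ≤-Reasoning

module _ {X : Set} (P : X → Bool) where

  all-++ : ∀ xs ys → all P (xs ++ ys) ≡ all P xs ∧ all P ys
  all-++ [] ys = refl
  all-++ (x ∷ xs) ys = trans (cong (P x ∧_) (all-++ xs ys)) (sym (∧-assoc (P x) (all P xs) (all P ys)))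

  all⇒ : ∀ {xs x} → all P xs ≡ true → x ∈ˡ xs → P x ≡ true
  all⇒ {y ∷ xs} all≡true (here refl) with P y | all≡true
  ... | true | _ = refl
  all⇒ {y ∷ xs} all≡true (there x∈xs) with P y | all≡true
  ... | true | all′≡true = all⇒ all′≡true x∈xs

  all-partition : ∀ (Q : X → Bool) xs → all P xs ≡ all P (filterᵇ Q xs) ∧ all P (filterᵇ (not ∘ Q) xs)
  all-partition Q [] = refl
  all-partition Q (x ∷ xs) with Q x
  ... | true = trans (cong (P x ∧_) (all-partition Q xs)) (sym (∧-assoc (P x) _ _))
  ... | false = trans (cong (P x ∧_) (all-partition Q xs))
                      (∧-swapˡ (P x) (all P (filterᵇ Q xs)) (all P (filterᵇ (not ∘ Q) xs)))
    where
    ∧-swapˡ : ∀ s t u → s ∧ (t ∧ u) ≡ t ∧ (s ∧ u)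
    ∧-swapˡ true t u = refl
    ∧-swapˡ false t u = sym (∧-zeroʳ t)

length-partition : ∀ {X : Set} (Q : X → Bool) xs → length (filterᵇ Q xs) + length (filterᵇ (not ∘ Q) xs) ≡ length xs
length-partition Q [] = refl
length-partition Q (x ∷ xs) with Q x
... | true = cong suc (length-partition Q xs)
... | false = trans (+-suc _ _) (cong suc (length-partition Q xs))

module _ {X : Set} (P : X → Bool) where

  length-filterᵇ-++ : ∀ xs ys → length (filterᵇ P (xs ++ ys)) ≡ length (filterᵇ P xs) + length (filterᵇ P ys)
  length-filterᵇ-++ xs ys = trans (cong length (filter-++ (T? ∘ P) xs ys)) (length-++ (filterᵇ P xs))

  length-filterᵇ-tabulate : ∀ {n} (f : Fin n → X) → length (filterᵇ P (List.tabulate f)) ≡ ∑[ i < n ] ⟦ P (f i) ⟧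
  length-filterᵇ-tabulate {zero} f = refl
  length-filterᵇ-tabulate {suc n} f with P (f zero)
  ... | true = cong suc (length-filterᵇ-tabulate (f ∘ suc))
  ... | false = length-filterᵇ-tabulate (f ∘ suc)

module _ {X Y : Set} where

  length-filterᵇ-map : ∀ (P : Y → Bool) (h : X → Y) xs → length (filterᵇ P (map h xs)) ≡ length (filterᵇ (P ∘ h) xs)
  length-filterᵇ-map P h [] = refl
  length-filterᵇ-map P h (x ∷ xs) with P (h x)
  ... | true = cong suc (length-filterᵇ-map P h xs)
  ... | false = length-filterᵇ-map P h xs

  ∏-filterᵇ-map : ∀ (g : Y → ℕ) {α} (P : Y → Bool) (h : X → Y) → (∀ x → g (h x) ≡ α) →
    ∀ xs → ∏ g (filterᵇ P (map h xs)) ≡ α ^ length (filterᵇ (P ∘ h) xs)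
  ∏-filterᵇ-map g P h g∘h≡α [] = refl
  ∏-filterᵇ-map g P h g∘h≡α (x ∷ xs) with P (h x)
  ... | true = cong₂ _*_ (g∘h≡α x) (∏-filterᵇ-map g P h g∘h≡α xs)
  ... | false = ∏-filterᵇ-map g P h g∘h≡α xs

length-filterᵇ-allPairs : ∀ {m n} (P : Fin m × Fin n → Bool) →
  length (filterᵇ P (cartesianProduct (allFin m) (allFin n))) ≡ ∑[ u < m ] ∑[ w < n ] ⟦ P (u , w) ⟧
length-filterᵇ-allPairs {m} {n} P = go (λ u → u)
  where
  go : ∀ {k} (f : Fin k → Fin m) →
    length (filterᵇ P (cartesianProduct (List.tabulate f) (allFin n))) ≡ ∑[ u < k ] ∑[ w < n ] ⟦ P (f u , w) ⟧
  go {zero} f = refl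
  go {suc k} f = begin
    length (filterᵇ P (map (f zero ,_) (allFin n) ++ cartesianProduct (List.tabulate (f ∘ suc)) (allFin n)))
      ≡⟨ length-filterᵇ-++ P (map (f zero ,_) (allFin n)) _ ⟩
    length (filterᵇ P (map (f zero ,_) (allFin n))) + length (filterᵇ P (cartesianProduct (List.tabulate (f ∘ suc)) (allFin n)))
      ≡⟨ cong₂ _+_ (trans (length-filterᵇ-map P (f zero ,_) (allFin n))
                          (length-filterᵇ-tabulate (P ∘ (f zero ,_)) (λ w → w)))
                   (go (f ∘ suc)) ⟩
    ∑[ w < n ] ⟦ P (f zero , w) ⟧ + ∑[ u < k ] ∑[ w < n ] ⟦ P (f (suc u) , w) ⟧ ∎
    where open ≡-Reasoning

∑-meets≤ : ∀ {m n δ} (U : Fin n → Bool) (W : Fin m → Fin n → Bool) →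
  (∀ z → ∑[ j < m ] ⟦ W j z ⟧ ≤ δ) → ∑[ j < m ] ⟦ meets U (W j) ⟧ ≤ ∑[ z < n ] ⟦ U z ⟧ * δ
∑-meets≤ {m} {n} {δ} U W deg = begin
  ∑[ j < m ] ⟦ meets U (W j) ⟧                 ≤⟨ ∑-mono-≤ (λ j → ⟦meets⟧≤∑ U (W j)) ⟩
  ∑[ j < m ] ∑[ z < n ] (⟦ U z ⟧ * ⟦ W j z ⟧)  ≡⟨ ∑∑-weighted-swap U (λ j z → ⟦ W j z ⟧) ⟩
  ∑[ z < n ] (⟦ U z ⟧ * ∑[ j < m ] ⟦ W j z ⟧)  ≤⟨ ∑-weighted≤ U deg ⟩
  ∑[ z < n ] ⟦ U z ⟧ * δ                       ∎
  where open ≤-Reasoning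

∑∑-meets≤ : ∀ {m m′ n δ} (U : Fin n → Bool) (W : Fin m → Fin m′ → Fin n → Bool) →
  (∀ z → ∑[ u < m ] ∑[ w < m′ ] ⟦ W u w z ⟧ ≤ δ) →
  ∑[ u < m ] ∑[ w < m′ ] ⟦ meets U (W u w) ⟧ ≤ ∑[ z < n ] ⟦ U z ⟧ * δ
∑∑-meets≤ {m} {m′} {n} {δ} U W deg = begin
  ∑[ u < m ] ∑[ w < m′ ] ⟦ meets U (W u w) ⟧
    ≤⟨ ∑-mono-≤ (λ u → ∑-mono-≤ (λ w → ⟦meets⟧≤∑ U (W u w))) ⟩
  ∑[ u < m ] ∑[ w < m′ ] ∑[ z < n ] (⟦ U z ⟧ * ⟦ W u w z ⟧)
    ≡⟨ sum-cong-≗ (λ u → ∑∑-weighted-swap U (λ w z → ⟦ W u w z ⟧)) ⟩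
  ∑[ u < m ] ∑[ z < n ] (⟦ U z ⟧ * ∑[ w < m′ ] ⟦ W u w z ⟧)
    ≡⟨ ∑∑-weighted-swap U (λ u z → ∑[ w < m′ ] ⟦ W u w z ⟧) ⟩
  ∑[ z < n ] (⟦ U z ⟧ * ∑[ u < m ] ∑[ w < m′ ] ⟦ W u w z ⟧)
    ≤⟨ ∑-weighted≤ U deg ⟩
  ∑[ z < n ] ⟦ U z ⟧ * δ ∎
  where open ≤-Reasoning

-- The local lemma

-- The asymmetric local lemma in counting form, with weights x i = p i / q i. After division by b ^ n,
-- the hypothesis of ∃-avoiding-all reads P(A i) ≤ x i ∏ (1 − x j) over the neighbours j of i, and
-- ConditionalBound S reads P(A i | no event of S occurs) ≤ x i, proved by induction on the length of S.
module LovaszLocalLemma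
  {b n : ℕ} .{{_ : NonZero b}} {Ev : Set} (events : List Ev)
  (A : Ev → Vec (Fin b) n → Bool) (V : Ev → Fin n → Bool) (A-local : ∀ i → DependsOn (V i) (A i))
  (p q : Ev → ℕ) (p<q : ∀ i → p i < q i)
  where

  r : Ev → ℕ
  r i = q i ∸ p i

  adjacent : Ev → Ev → Bool
  adjacent i j = meets (V i) (V j)

  neighbours : Ev → List Ev
  neighbours i = filterᵇ (adjacent i) events

  avoids : List Ev → Vec (Fin b) n → Bool
  avoids S ω = all (λ j → not (A j ω)) S

  ConditionalBound : List Ev → Set
  ConditionalBound S =
    ∀ i → i ∈ˡ events → count n (λ ω → A i ω ∧ avoids S ω) * q i ≤ p i * count n (avoids S)

  BoundedBelow : ℕ → Set
  BoundedBelow m = ∀ T → length T < m → Unique T → T ⊆ events → ConditionalBound T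

  count-avoids-∷ : ∀ j T → count n (avoids T) ≡ count n (λ ω → A j ω ∧ avoids T ω) + count n (avoids (j ∷ T))
  count-avoids-∷ j T = trans (∑Ω-cong n (λ ω → ⟦⟧-split (A j ω) (avoids T ω))) (∑Ω-distrib-+ n _ _)

  r*count≤q*count-avoids-∷ : ∀ j T → j ∈ˡ events → ConditionalBound T →
    r j * count n (avoids T) ≤ q j * count n (avoids (j ∷ T))
  r*count≤q*count-avoids-∷ j T j∈E bound = +-cancelʳ-≤ (p j * C) (r j * C) (q j * Z) (begin
    r j * C + p j * C    ≡⟨ *-distribʳ-+ C (r j) (p j) ⟨
    (r j + p j) * C      ≡⟨ cong (_* C) (m∸n+n≡m (<⇒≤ (p<q j))) ⟩
    q j * C              ≡⟨ cong (q j *_) (count-avoids-∷ j T) ⟩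
    q j * (Y + Z)        ≡⟨ *-distribˡ-+ (q j) Y Z ⟩
    q j * Y + q j * Z    ≤⟨ +-monoˡ-≤ (q j * Z) (≤-trans (≤-reflexive (*-comm (q j) Y)) (bound j j∈E)) ⟩
    p j * C + q j * Z    ≡⟨ +-comm (p j * C) (q j * Z) ⟩
    q j * Z + p j * C    ∎)
    where
    open ≤-Reasoning
    C : ℕ
    C = count n (avoids T)
    Y : ℕ
    Y = count n (λ ω → A j ω ∧ avoids T ω)
    Z : ℕ
    Z = count n (avoids (j ∷ T))

  ∏r*count≤∏q*count-avoids-++ : ∀ L R → BoundedBelow (length (L ++ R)) → Unique (L ++ R) → L ++ R ⊆ events →
    ∏ r L * count n (avoids R) ≤ ∏ q L * count n (avoids (L ++ R))
  ∏r*count≤∏q*count-avoids-++ [] R _ _ _ = ≤-reflexive (trans (*-identityˡ _) (sym (*-identityˡ _)))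
  ∏r*count≤∏q*count-avoids-++ (j ∷ L) R below (_ ∷ LR!) jLR⊆E = begin
    r j * ∏ r L * C
      ≡⟨ *-assoc (r j) (∏ r L) C ⟩
    r j * (∏ r L * C)
      ≤⟨ *-monoʳ-≤ (r j) (∏r*count≤∏q*count-avoids-++ L R (λ T T< → below T (m<n⇒m<1+n T<)) LR! LR⊆E) ⟩
    r j * (∏ q L * X)
      ≡⟨ x*[y*z]≡y*[x*z] (r j) (∏ q L) X ⟩
    ∏ q L * (r j * X)          ≤⟨ *-monoʳ-≤ (∏ q L) (r*count≤q*count-avoids-∷ j (L ++ R) (jLR⊆E (here refl))
                                                       (below (L ++ R) ≤-refl LR! LR⊆E)) ⟩
    ∏ q L * (q j * Z)
      ≡⟨ x*[y*z]≡y*[x*z] (∏ q L) (q j) Z ⟩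
    q j * (∏ q L * Z)
      ≡⟨ *-assoc (q j) (∏ q L) Z ⟨
    q j * ∏ q L * Z ∎
    where
    open ≤-Reasoning
    C : ℕ
    C = count n (avoids R)
    X : ℕ
    X = count n (avoids (L ++ R))
    Z : ℕ
    Z = count n (avoids (j ∷ L ++ R))
    LR⊆E : L ++ R ⊆ events
    LR⊆E x∈LR = jLR⊆E (there x∈LR)
    x*[y*z]≡y*[x*z] : ∀ x y z → x * (y * z) ≡ y * (x * z)
    x*[y*z]≡y*[x*z] = solve-∀

  module _ (i : Ev) (S : List Ev) where

    adjacentIn nonadjacentIn : List Ev
    adjacentIn = filterᵇ (adjacent i) S
    nonadjacentIn = filterᵇ (not ∘ adjacent i) S

    avoids-partition : ∀ ω → avoids S ω ≡ avoids adjacentIn ω ∧ avoids nonadjacentIn ω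
    avoids-partition ω = all-partition _ (adjacent i) S

    count-A∧avoids≤ : count n (λ ω → A i ω ∧ avoids S ω) ≤ count n (λ ω → A i ω ∧ avoids nonadjacentIn ω)
    count-A∧avoids≤ = ∑Ω-mono-≤ n (λ ω → subst (λ t → ⟦ A i ω ∧ t ⟧ ≤ ⟦ A i ω ∧ avoids nonadjacentIn ω ⟧)
                                               (sym (avoids-partition ω))
                                               (drop-middle (A i ω) (avoids adjacentIn ω) (avoids nonadjacentIn ω)))
      where
      drop-middle : ∀ a s t → ⟦ a ∧ (s ∧ t) ⟧ ≤ ⟦ a ∧ t ⟧
      drop-middle false s t = z≤n
      drop-middle true true t = ≤-refl
      drop-middle true false t = z≤n

    avoids-nonadjacent-local : DependsOn (not ∘ V i) (avoids nonadjacentIn)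
    avoids-nonadjacent-local = local S
      where
      local : ∀ S → DependsOn (not ∘ V i) (avoids (filterᵇ (not ∘ adjacent i) S))
      local [] ω ω′ _ = refl
      local (j ∷ S) ω ω′ ω≈ω′ with adjacent i j in i≁j
      ... | true = local S ω ω′ ω≈ω′
      ... | false = cong₂ (λ a t → not a ∧ t)
                      (A-local j ω ω′ (λ z Vjz → ω≈ω′ z (cong not (meets≡false (V i) (V j) i≁j z Vjz))))
                      (local S ω ω′ ω≈ω′)

    count-A∧avoids-independent :
      count n (λ ω → A i ω ∧ avoids nonadjacentIn ω) * b ^ n ≡ count n (A i) * count n (avoids nonadjacentIn)
    count-A∧avoids-independent =
      trans (cong (_* b ^ n) (∑Ω-cong n (λ ω → ⟦∧⟧ (A i ω) (avoids nonadjacentIn ω))))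
            (∑Ω-independent n (V i) (λ ω ω′ ω≈ω′ → cong ⟦_⟧ (A-local i ω ω′ ω≈ω′))
                                    (λ ω ω′ ω≈ω′ → cong ⟦_⟧ (avoids-nonadjacent-local ω ω′ ω≈ω′)))

    module _ (S! : Unique S) (S⊆E : S ⊆ events) where

      adjacentIn! : Unique adjacentIn
      adjacentIn! = Unique.filter⁺ (T? ∘ adjacent i) S!

      ∏-neighbours≤∏-adjacentIn : ∏ r (neighbours i) * ∏ q adjacentIn ≤ ∏ r adjacentIn * ∏ q (neighbours i)
      ∏-neighbours≤∏-adjacentIn = ∏-⊆ (λ j → m∸n≤m (q j) (p j)) adjacentIn (neighbours i) adjacentIn! adjacentIn⊆N
        where
        adjacentIn⊆N : adjacentIn ⊆ neighbours i
        adjacentIn⊆N j∈S₁ with j∈S , ij ← ∈-filter⁻ (T? ∘ adjacent i) j∈S₁ =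
          ∈-filter⁺ (T? ∘ adjacent i) (S⊆E j∈S) ij

      ∏r*count≤∏q*count-avoids : BoundedBelow (length S) →
        ∏ r adjacentIn * count n (avoids nonadjacentIn) ≤ ∏ q adjacentIn * count n (avoids S)
      ∏r*count≤∏q*count-avoids below =
        subst (λ t → ∏ r adjacentIn * count n (avoids nonadjacentIn) ≤ ∏ q adjacentIn * t)
              (∑Ω-cong n (λ ω → cong ⟦_⟧ (trans (all-++ _ adjacentIn nonadjacentIn) (sym (avoids-partition ω)))))
              (∏r*count≤∏q*count-avoids-++ adjacentIn nonadjacentIn below′ split! split⊆E)
        where
        below′ : BoundedBelow (length (adjacentIn ++ nonadjacentIn))
        below′ rewrite length-++ adjacentIn {nonadjacentIn} | length-partition (adjacent i) S = below
        split! : Unique (adjacentIn ++ nonadjacentIn)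
        split! = Unique.++⁺ adjacentIn! (Unique.filter⁺ (T? ∘ not ∘ adjacent i) S!) disjoint
          where
          disjoint : ∀ {j} → j ∈ˡ adjacentIn × j ∈ˡ nonadjacentIn → ⊥
          disjoint {j} (j∈S₁ , j∈S₂) with adjacent i j | proj₂ (∈-filter⁻ (T? ∘ adjacent i) {xs = S} j∈S₁)
                                                      | proj₂ (∈-filter⁻ (T? ∘ not ∘ adjacent i) {xs = S} j∈S₂)
          ... | true | _ | ()
        split⊆E : adjacentIn ++ nonadjacentIn ⊆ events
        split⊆E j∈S₁S₂ with ∈-++⁻ adjacentIn j∈S₁S₂
        ... | inj₁ j∈S₁ = S⊆E (proj₁ (∈-filter⁻ (T? ∘ adjacent i) j∈S₁))
        ... | inj₂ j∈S₂ = S⊆E (proj₁ (∈-filter⁻ (T? ∘ not ∘ adjacent i) j∈S₂))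

  module _ (hyp : ∀ i → i ∈ˡ events →
                  count n (A i) * q i * ∏ q (neighbours i) ≤ p i * ∏ r (neighbours i) * b ^ n) where

    conditionalBound : ∀ S → BoundedBelow (length S) → Unique S → S ⊆ events → ConditionalBound S
    conditionalBound S below S! S⊆E i i∈E = *-cancelʳ-≤ (X * q i) (p i * C) K {{K≢0}} (begin
      X * q i * K
        ≤⟨ *-monoˡ-≤ K (*-monoˡ-≤ (q i) (count-A∧avoids≤ i S)) ⟩
      Y * q i * K
        ≡⟨ rearrange₁ Y (q i) (∏ q N) (∏ q S₁) M ⟩
      Y * M * q i * ∏ q N * ∏ q S₁
        ≡⟨ cong (λ t → t * q i * ∏ q N * ∏ q S₁) (count-A∧avoids-independent i S) ⟩
      cA * C₂ * q i * ∏ q N * ∏ q S₁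
        ≡⟨ rearrange₂ cA C₂ (q i) (∏ q N) (∏ q S₁) ⟩
      (cA * q i * ∏ q N) * (C₂ * ∏ q S₁)
        ≤⟨ *-monoˡ-≤ (C₂ * ∏ q S₁) (hyp i i∈E) ⟩
      (p i * ∏ r N * M) * (C₂ * ∏ q S₁)
        ≡⟨ rearrange₃ (p i) (∏ r N) M C₂ (∏ q S₁) ⟩
      (p i * M * C₂) * (∏ r N * ∏ q S₁)
        ≤⟨ *-monoʳ-≤ (p i * M * C₂) (∏-neighbours≤∏-adjacentIn i S S! S⊆E) ⟩
      (p i * M * C₂) * (∏ r S₁ * ∏ q N)
        ≡⟨ rearrange₄ (p i) M C₂ (∏ r S₁) (∏ q N) ⟩
      (p i * M * ∏ q N) * (∏ r S₁ * C₂)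
        ≤⟨ *-monoʳ-≤ (p i * M * ∏ q N) (∏r*count≤∏q*count-avoids i S S! S⊆E below) ⟩
      (p i * M * ∏ q N) * (∏ q S₁ * C)
        ≡⟨ rearrange₅ (p i) M (∏ q N) (∏ q S₁) C ⟩
      p i * C * K ∎)
      where
      open ≤-Reasoning
      S₁ : List Ev
      S₁ = adjacentIn i S
      N : List Ev
      N = neighbours i
      M : ℕ
      M = b ^ n
      K : ℕ
      K = ∏ q N * ∏ q S₁ * M
      X : ℕ
      X = count n (λ ω → A i ω ∧ avoids S ω)
      Y : ℕ
      Y = count n (λ ω → A i ω ∧ avoids (nonadjacentIn i S) ω)
      C : ℕ
      C = count n (avoids S)
      C₂ : ℕ
      C₂ = count n (avoids (nonadjacentIn i S))
      cA : ℕ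
      cA = count n (A i)
      K≢0 : NonZero K
      K≢0 = >-nonZero (*-mono-≤ (*-mono-≤ (∏>0 q>0 N) (∏>0 q>0 S₁)) (m^n>0 b n))
        where
        q>0 : ∀ j → 0 < q j
        q>0 j = m<n⇒0<n (p<q j)
      rearrange₁ : ∀ y u v w m → y * u * (v * w * m) ≡ y * m * u * v * w
      rearrange₁ = solve-∀
      rearrange₂ : ∀ a c u v w → a * c * u * v * w ≡ (a * u * v) * (c * w)
      rearrange₂ = solve-∀
      rearrange₃ : ∀ a u m c w → (a * u * m) * (c * w) ≡ (a * m * c) * (u * w)
      rearrange₃ = solve-∀
      rearrange₄ : ∀ a m c u w → (a * m * c) * (u * w) ≡ (a * m * w) * (u * c)
      rearrange₄ = solve-∀
      rearrange₅ : ∀ a m v w c → (a * m * v) * (w * c) ≡ a * c * (v * w * m)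
      rearrange₅ = solve-∀

    conditionalBound-all : ∀ m S → length S < m → Unique S → S ⊆ events → ConditionalBound S
    conditionalBound-all (suc m) S (s≤s |S|≤m) =
      conditionalBound S (λ T |T|<|S| → conditionalBound-all m T (≤-trans |T|<|S| |S|≤m))

    ∃-avoiding-all : Unique events → Σ (Vec (Fin b) n) (λ ω → ∀ {i} → i ∈ˡ events → A i ω ≡ false)
    ∃-avoiding-all events! = ω , λ i∈E → not≡true⇒≡false (all⇒ _ (⟦⟧>0⇒≡true avoids>0) (∈-++⁺ˡ i∈E))
      where
      events′ : List Ev
      events′ = events ++ []
      events′⊆events : events′ ⊆ events
      events′⊆events = subst (_⊆ events) (sym (++-identityʳ events)) (λ x∈E → x∈E)
      lower : ∏ r events * count n (avoids []) ≤ ∏ q events * count n (avoids events′)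
      lower = ∏r*count≤∏q*count-avoids-++ events [] (λ T _ → conditionalBound-all (suc (length T)) T ≤-refl)
                (subst Unique (sym (++-identityʳ events)) events!) events′⊆events
      ∏r*M>0 : 0 < ∏ r events * count n (avoids [])
      ∏r*M>0 = *-mono-≤ (∏>0 (λ j → m<n⇒0<n∸m (p<q j)) events)
                        (subst (0 <_) (sym (trans (∑Ω-const {b} n 1) (*-identityˡ (b ^ n)))) (m^n>0 b n))
      count>0 : 0 < count n (avoids events′)
      count>0 = >-nonZero⁻¹ _ {{m*n≢0⇒n≢0 (∏ q events) {{>-nonZero (≤-trans ∏r*M>0 lower)}}}}
      witness : Σ (Vec (Fin b) n) (λ ω → 0 < ⟦ avoids events′ ω ⟧)
      witness = ∑Ω>0⇒term>0 n (λ ω → ⟦ avoids events′ ω ⟧) count>0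
      ω : Vec (Fin b) n
      ω = proj₁ witness
      avoids>0 : 0 < ⟦ avoids events′ ω ⟧
      avoids>0 = proj₂ witness
      not≡true⇒≡false : ∀ {t} → not t ≡ true → t ≡ false
      not≡true⇒≡false {false} _ = refl

^-distribʳ-* : ∀ x y k → (x * y) ^ k ≡ x ^ k * y ^ k
^-distribʳ-* x y zero = refl
^-distribʳ-* x y (suc k) =
  trans (cong (x * y *_) (^-distribʳ-* x y k)) (swap-middle x y (x ^ k) (y ^ k))
  where
  swap-middle : ∀ a b c d → a * b * (c * d) ≡ a * c * (b * d)
  swap-middle = solve-∀

^-double : ∀ x k → x ^ (2 * k) ≡ x ^ k * x ^ k
^-double x k = trans (cong (λ j → x ^ (k + j)) (+-identityʳ k)) (^-distribˡ-+-* x k k)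

m*m≤n*n⇒m≤n : ∀ {m n} → m * m ≤ n * n → m ≤ n
m*m≤n*n⇒m≤n {m} {n} m²≤n² with m ≤? n
... | yes m≤n = m≤n
... | no m≰n = contradiction m²≤n² (<⇒≱ (*-mono-< (≰⇒> m≰n) (≰⇒> m≰n)))

m*[m∸[s+t]]≤[m∸s]*[m∸t] : ∀ m s t → m * (m ∸ (s + t)) ≤ (m ∸ s) * (m ∸ t)
m*[m∸[s+t]]≤[m∸s]*[m∸t] m s t with s + t ≤? m
... | no s+t≰m = ≤-trans (≤-reflexive (trans (cong (m *_) (m≤n⇒m∸n≡0 (<⇒≤ (≰⇒> s+t≰m)))) (*-zeroʳ m))) z≤n
... | yes s+t≤m =
  subst (λ m′ → m′ * (m ∸ (s + t)) ≤ (m′ ∸ s) * (m′ ∸ t)) (m∸n+n≡m s+t≤m) (expanded (m ∸ (s + t)))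
  where
  expanded : ∀ u → (u + (s + t)) * u ≤ (u + (s + t) ∸ s) * (u + (s + t) ∸ t)
  expanded u = begin
    (u + (s + t)) * u              ≤⟨ m≤m+n _ (t * s) ⟩
    (u + (s + t)) * u + t * s      ≡⟨ expand u s t ⟩
    (u + t) * (u + s)              ≡⟨ cong₂ _*_ (minus s (u + t) (+-assoc-comm u s t)) (minus t (u + s) (sym (+-assoc u s t))) ⟨
    (u + (s + t) ∸ s) * (u + (s + t) ∸ t) ∎
    where
    open ≤-Reasoning
    expand : ∀ u s t → (u + (s + t)) * u + t * s ≡ (u + t) * (u + s)
    expand = solve-∀
    +-assoc-comm : ∀ u s t → u + (s + t) ≡ u + t + s
    +-assoc-comm = solve-∀
    minus : ∀ x y {z} → z ≡ y + x → z ∸ x ≡ y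
    minus x y refl = m+n∸n≡m y x

-- Bernoulli's inequality (1 − p/Q)^m ≥ 1 − mp/Q with denominators cleared.
bernoulli : ∀ Q p m → Q ^ m * (Q ∸ m * p) ≤ (Q ∸ p) ^ m * Q
bernoulli Q p zero = ≤-reflexive (trans (*-identityˡ Q) (sym (*-identityˡ Q)))
bernoulli Q p (suc m) = begin
  Q * Q ^ m * (Q ∸ (p + m * p))    ≡⟨ x*y*z≡y*[x*z] Q (Q ^ m) (Q ∸ (p + m * p)) ⟩
  Q ^ m * (Q * (Q ∸ (p + m * p)))  ≤⟨ *-monoʳ-≤ (Q ^ m) (m*[m∸[s+t]]≤[m∸s]*[m∸t] Q p (m * p)) ⟩
  Q ^ m * ((Q ∸ p) * (Q ∸ m * p))  ≡⟨ x*[y*z]≡y*[x*z] (Q ^ m) (Q ∸ p) (Q ∸ m * p) ⟩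
  (Q ∸ p) * (Q ^ m * (Q ∸ m * p))  ≤⟨ *-monoʳ-≤ (Q ∸ p) (bernoulli Q p m) ⟩
  (Q ∸ p) * ((Q ∸ p) ^ m * Q)      ≡⟨ *-assoc (Q ∸ p) ((Q ∸ p) ^ m) Q ⟨
  (Q ∸ p) * (Q ∸ p) ^ m * Q        ∎
  where
  open ≤-Reasoning
  x*y*z≡y*[x*z] : ∀ x y z → x * y * z ≡ y * (x * z)
  x*y*z≡y*[x*z] = solve-∀
  x*[y*z]≡y*[x*z] : ∀ x y z → x * (y * z) ≡ y * (x * z)
  x*[y*z]≡y*[x*z] = solve-∀

bernoulli-scaled : ∀ c e Q p m .{{_ : NonZero Q}} →
  c * Q + e * (m * p) ≤ e * Q → c * Q ^ m ≤ e * (Q ∸ p) ^ m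
bernoulli-scaled c e Q p m hyp = *-cancelʳ-≤ (c * Q ^ m) (e * (Q ∸ p) ^ m) Q (begin
  c * Q ^ m * Q              ≡⟨ x*y*z≡y*[x*z] c (Q ^ m) Q ⟩
  Q ^ m * (c * Q)            ≤⟨ *-monoʳ-≤ (Q ^ m) cQ≤e[Q∸mp] ⟩
  Q ^ m * (e * (Q ∸ m * p))  ≡⟨ x*[y*z]≡y*[x*z] (Q ^ m) e (Q ∸ m * p) ⟩
  e * (Q ^ m * (Q ∸ m * p))  ≤⟨ *-monoʳ-≤ e (bernoulli Q p m) ⟩
  e * ((Q ∸ p) ^ m * Q)      ≡⟨ *-assoc e ((Q ∸ p) ^ m) Q ⟨
  e * (Q ∸ p) ^ m * Q        ∎)
  where
  open ≤-Reasoning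
  x*y*z≡y*[x*z] : ∀ x y z → x * y * z ≡ y * (x * z)
  x*y*z≡y*[x*z] = solve-∀
  x*[y*z]≡y*[x*z] : ∀ x y z → x * (y * z) ≡ y * (x * z)
  x*[y*z]≡y*[x*z] = solve-∀
  cQ≤e[Q∸mp] : c * Q ≤ e * (Q ∸ m * p)
  cQ≤e[Q∸mp] = subst (c * Q ≤_) (sym (*-distribˡ-∸ e Q (m * p))) (m+n≤o⇒m≤o∸n (c * Q) hyp)

^-ratio-mono : ∀ {x y m m′} L K .{{_ : NonZero x}} → x ≤ y → m ≤ m′ →
  L * y ^ m′ ≤ K * x ^ m′ → L * y ^ m ≤ K * x ^ m
^-ratio-mono {x} {y} {m} {m′} L K x≤y m≤m′ hyp =
  *-cancelʳ-≤ (L * y ^ m) (K * x ^ m) (x ^ m′) {{m^n≢0 x m′}} (begin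
    L * y ^ m * x ^ m′           ≡⟨ cong (λ j → L * y ^ m * x ^ j) m+t≡m′ ⟨
    L * y ^ m * x ^ (m + t)      ≡⟨ cong (L * y ^ m *_) (^-distribˡ-+-* x m t) ⟩
    L * y ^ m * (x ^ m * x ^ t)  ≤⟨ *-monoʳ-≤ (L * y ^ m) (*-monoʳ-≤ (x ^ m) (^-monoˡ-≤ t x≤y)) ⟩
    L * y ^ m * (x ^ m * y ^ t)  ≡⟨ rearrange L (y ^ m) (x ^ m) (y ^ t) ⟩
    L * (y ^ m * y ^ t) * x ^ m  ≡⟨ cong (λ z → L * z * x ^ m) (^-distribˡ-+-* y m t) ⟨
    L * y ^ (m + t) * x ^ m      ≡⟨ cong (λ j → L * y ^ j * x ^ m) m+t≡m′ ⟩
    L * y ^ m′ * x ^ m           ≤⟨ *-monoˡ-≤ (x ^ m) hyp ⟩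
    K * x ^ m′ * x ^ m           ≡⟨ x*y*z≡x*z*y K (x ^ m′) (x ^ m) ⟩
    K * x ^ m * x ^ m′           ∎)
  where
  open ≤-Reasoning
  t : ℕ
  t = m′ ∸ m
  m+t≡m′ : m + t ≡ m′
  m+t≡m′ = m+[n∸m]≡n m≤m′
  rearrange : ∀ l a c e → l * a * (c * e) ≡ l * (a * e) * c
  rearrange = solve-∀
  x*y*z≡x*z*y : ∀ x y z → x * y * z ≡ x * z * y
  x*y*z≡x*z*y = solve-∀

infix 8 _↓_

_↓_ : ℕ → ℕ → ℕ
n ↓ zero = 1
n ↓ suc k = n * (pred n ↓ k)

↓-monoˡ-≤ : ∀ {m n} k → m ≤ n → m ↓ k ≤ n ↓ k
↓-monoˡ-≤ zero m≤n = ≤-refl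
↓-monoˡ-≤ (suc k) m≤n = *-mono-≤ m≤n (↓-monoˡ-≤ k (pred-mono-≤ m≤n))

n<k⇒n↓k≡0 : ∀ {n k} → n < k → n ↓ k ≡ 0
n<k⇒n↓k≡0 {zero} {suc k} _ = refl
n<k⇒n↓k≡0 {suc n} {suc k} (s≤s n<k) = trans (cong (suc n *_) (n<k⇒n↓k≡0 n<k)) (*-zeroʳ (suc n))

n↓k≤n^k : ∀ n k → n ↓ k ≤ n ^ k
n↓k≤n^k n zero = ≤-refl
n↓k≤n^k n (suc k) = *-monoʳ-≤ n (≤-trans (n↓k≤n^k (pred n) k) (^-monoˡ-≤ k pred[n]≤n))

n↓n≡n! : ∀ n → n ↓ n ≡ n !
n↓n≡n! zero = refl
n↓n≡n! (suc n) = cong (suc n *_) (n↓n≡n! n)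

n↓[1+k]≡n↓k*[n∸k] : ∀ n k → n ↓ suc k ≡ n ↓ k * (n ∸ k)
n↓[1+k]≡n↓k*[n∸k] n zero = trans (*-identityʳ n) (sym (*-identityˡ n))
n↓[1+k]≡n↓k*[n∸k] zero (suc k) = refl
n↓[1+k]≡n↓k*[n∸k] (suc n) (suc k) =
  trans (cong (suc n *_) (n↓[1+k]≡n↓k*[n∸k] n k)) (sym (*-assoc (suc n) (n ↓ k) (n ∸ k)))

binom*k!≡n↓k : ∀ n k → binom n k * k ! ≡ n ↓ k
binom*k!≡n↓k n zero = refl
binom*k!≡n↓k zero (suc k) = refl
binom*k!≡n↓k (suc n) (suc k) = begin
  (binom n k + binom n (suc k)) * (suc k * k !)
    ≡⟨ distribute (binom n k) (binom n (suc k)) (suc k) (k !) ⟩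
  suc k * (binom n k * k !) + binom n (suc k) * (suc k * k !)
    ≡⟨ cong₂ (λ x y → suc k * x + y) (binom*k!≡n↓k n k) (binom*k!≡n↓k n (suc k)) ⟩
  suc k * (n ↓ k) + n ↓ suc k
    ≡⟨ cong (suc k * (n ↓ k) +_) (n↓[1+k]≡n↓k*[n∸k] n k) ⟩
  suc k * (n ↓ k) + n ↓ k * (n ∸ k)
    ≡⟨ collect k n ⟩
  suc n * (n ↓ k) ∎
  where
  open ≡-Reasoning
  distribute : ∀ x y s f → (x + y) * (s * f) ≡ s * (x * f) + y * (s * f)
  distribute = solve-∀
  collect : ∀ k n → suc k * (n ↓ k) + n ↓ k * (n ∸ k) ≡ suc n * (n ↓ k)
  collect k n with k ≤? n
  ... | yes k≤n = begin
    suc k * (n ↓ k) + n ↓ k * (n ∸ k)   ≡⟨ cong (suc k * (n ↓ k) +_) (*-comm (n ↓ k) (n ∸ k)) ⟩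
    suc k * (n ↓ k) + (n ∸ k) * n ↓ k   ≡⟨ *-distribʳ-+ (n ↓ k) (suc k) (n ∸ k) ⟨
    (suc k + (n ∸ k)) * n ↓ k           ≡⟨ cong (λ j → suc j * n ↓ k) (m+[n∸m]≡n k≤n) ⟩
    suc n * n ↓ k                       ∎
  ... | no k≰n rewrite n<k⇒n↓k≡0 (≰⇒> k≰n) = trans (cong (_+ 0) (*-zeroʳ k)) (sym (*-zeroʳ n))

2d^m≤2*[2d∸1]^m : ∀ {d m} .{{_ : NonZero d}} → m ≤ d → (2 * d) ^ m ≤ 2 * (2 * d ∸ 1) ^ m
2d^m≤2*[2d∸1]^m {d} {m} m≤d = subst (_≤ 2 * (2 * d ∸ 1) ^ m) (*-identityˡ ((2 * d) ^ m))
  (bernoulli-scaled 1 2 (2 * d) 1 m {{m*n≢0 2 d}} (begin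
    1 * (2 * d) + 2 * (m * 1)  ≡⟨ normalise d m ⟩
    2 * d + 2 * m              ≤⟨ +-monoʳ-≤ (2 * d) (*-monoʳ-≤ 2 m≤d) ⟩
    2 * d + 2 * d              ≡⟨ double d ⟩
    2 * (2 * d)                ∎))
  where
  open ≤-Reasoning
  normalise : ∀ d m → 1 * (2 * d) + 2 * (m * 1) ≡ 2 * d + 2 * m
  normalise = solve-∀
  double : ∀ d → 2 * d + 2 * d ≡ 2 * (2 * d)
  double = solve-∀

2d^m≤4*[2d∸1]^m : ∀ {d Δ m} .{{_ : NonZero d}} → Δ ≤ d → m ≤ 2 * Δ → (2 * d) ^ m ≤ 4 * (2 * d ∸ 1) ^ m
2d^m≤4*[2d∸1]^m {d} {Δ} {m} Δ≤d m≤2Δ = subst (_≤ 4 * (2 * d ∸ 1) ^ m) (*-identityˡ ((2 * d) ^ m))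
  (^-ratio-mono 1 4 {{2d∸1≢0}} (m∸n≤m (2 * d) 1) m≤2Δ (begin
    1 * (2 * d) ^ (2 * Δ)                       ≡⟨ trans (*-identityˡ _) (^-double (2 * d) Δ) ⟩
    (2 * d) ^ Δ * (2 * d) ^ Δ                   ≤⟨ *-mono-≤ (2d^m≤2*[2d∸1]^m Δ≤d) (2d^m≤2*[2d∸1]^m Δ≤d) ⟩
    (2 * x ^ Δ) * (2 * x ^ Δ)                   ≡⟨ square-double (x ^ Δ) ⟩
    4 * (x ^ Δ * x ^ Δ)                         ≡⟨ cong (4 *_) (^-double x Δ) ⟨
    4 * x ^ (2 * Δ)                             ∎))
  where
  open ≤-Reasoning
  x : ℕ
  x = 2 * d ∸ 1
  2d∸1≢0 : NonZero x
  2d∸1≢0 = >-nonZero (m<n⇒0<n∸m (*-monoʳ-≤ 2 (>-nonZero⁻¹ d)))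
  square-double : ∀ y → (2 * y) * (2 * y) ≡ 4 * (y * y)
  square-double = solve-∀

3^k*b^m≤4^k*[b∸8]^m : ∀ {b n k m} → 32 * n ≤ b → 8 < b → m ≤ k * n → 3 ^ k * b ^ m ≤ 4 ^ k * (b ∸ 8) ^ m
3^k*b^m≤4^k*[b∸8]^m {b} {n} {k} {m} 32n≤b 8<b m≤kn =
  ^-ratio-mono (3 ^ k) (4 ^ k) {{b∸8≢0}} (m∸n≤m b 8) (≤-trans m≤kn (≤-reflexive (*-comm k n))) (begin
    3 ^ k * b ^ (n * k)           ≡⟨ cong (3 ^ k *_) (^-*-assoc b n k) ⟨
    3 ^ k * (b ^ n) ^ k           ≡⟨ ^-distribʳ-* 3 (b ^ n) k ⟨
    (3 * b ^ n) ^ k               ≤⟨ ^-monoˡ-≤ k base ⟩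
    (4 * (b ∸ 8) ^ n) ^ k         ≡⟨ ^-distribʳ-* 4 ((b ∸ 8) ^ n) k ⟩
    4 ^ k * ((b ∸ 8) ^ n) ^ k     ≡⟨ cong (4 ^ k *_) (^-*-assoc (b ∸ 8) n k) ⟩
    4 ^ k * (b ∸ 8) ^ (n * k)     ∎)
  where
  open ≤-Reasoning
  b∸8≢0 : NonZero (b ∸ 8)
  b∸8≢0 = >-nonZero (m<n⇒0<n∸m 8<b)
  base : 3 * b ^ n ≤ 4 * (b ∸ 8) ^ n
  base = bernoulli-scaled 3 4 b 8 n {{>-nonZero (m<n⇒0<n 8<b)}} (begin
    3 * b + 4 * (n * 8)  ≡⟨ cong (3 * b +_) (normalise n) ⟩
    3 * b + 32 * n       ≤⟨ +-monoʳ-≤ (3 * b) 32n≤b ⟩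
    3 * b + b            ≡⟨ collect b ⟩
    4 * b                ∎)
    where
    normalise : ∀ n → 4 * (n * 8) ≡ 32 * n
    normalise = solve-∀
    collect : ∀ b → 3 * b + b ≡ 4 * b
    collect = solve-∀

b^m≤2*[b∸8]^m : ∀ {b n m} → 32 * n ≤ b → 8 < b → m ≤ 2 * n → b ^ m ≤ 2 * (b ∸ 8) ^ m
b^m≤2*[b∸8]^m {b} {n} {m} 32n≤b 8<b m≤2n = subst (_≤ 2 * (b ∸ 8) ^ m) (*-identityˡ (b ^ m))
  (bernoulli-scaled 1 2 b 8 m {{>-nonZero (m<n⇒0<n 8<b)}} (begin
    1 * b + 2 * (m * 8)  ≡⟨ normalise b m ⟩
    b + 16 * m           ≤⟨ +-monoʳ-≤ b (*-monoʳ-≤ 16 m≤2n) ⟩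
    b + 16 * (2 * n)     ≡⟨ cong (b +_) (sym (*-assoc 16 2 n)) ⟩
    b + 32 * n           ≤⟨ +-monoʳ-≤ b 32n≤b ⟩
    b + b                ≡⟨ cong (b +_) (sym (+-identityʳ b)) ⟩
    2 * b                ∎))
  where
  open ≤-Reasoning
  normalise : ∀ b m → 1 * b + 2 * (m * 8) ≡ b + 16 * m
  normalise = solve-∀

-- After squaring, this follows from the density bound, binom a k * k ! ≤ a ^ k and
-- 4 ^ k * 4 ^ k ≤ 2 ^ k * 9 ^ k.
densityBound⇒levelCount≤ : ∀ {a} Δ⁺ Δ⁻ b k (𝓕 : Family a) .{{_ : NonZero a}} → DensityBound Δ⁺ Δ⁻ b k 𝓕 →
  levelCount 𝓕 k * k ! * (4 * (Δ⁺ * Δ⁻)) * 4 ^ k ≤ 3 ^ k * b ^ k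
densityBound⇒levelCount≤ {a} Δ⁺ Δ⁻ b k 𝓕 dense = m*m≤n*n⇒m≤n (begin
  (c * K * (4 * d) * 4 ^ k) * (c * K * (4 * d) * 4 ^ k) ≡⟨ square c K d (4 ^ k) ⟩
  Z * (4 ^ k * 4 ^ k)                                 ≡⟨ cong (Z *_) (trans (sym (^-distribʳ-* 4 4 k)) (^-distribʳ-* 2 8 k)) ⟩
  Z * (2 ^ k * 8 ^ k)                                 ≡⟨ *-assoc Z (2 ^ k) (8 ^ k) ⟨
  Z * 2 ^ k * 8 ^ k                                   ≤⟨ *-monoˡ-≤ (8 ^ k) Z*2^k≤b^2k ⟩
  b ^ (2 * k) * 8 ^ k                                 ≤⟨ *-monoʳ-≤ (b ^ (2 * k)) (^-monoˡ-≤ k (n≤1+n 8)) ⟩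
  b ^ (2 * k) * 9 ^ k                                 ≡⟨ cong₂ _*_ (^-double b k) (^-distribʳ-* 3 3 k) ⟩
  (b ^ k * b ^ k) * (3 ^ k * 3 ^ k)                   ≡⟨ swap-square (b ^ k) (3 ^ k) ⟩
  (3 ^ k * b ^ k) * (3 ^ k * b ^ k)                   ∎)
  where
  open ≤-Reasoning
  c : ℕ
  c = levelCount 𝓕 k
  d : ℕ
  d = Δ⁺ * Δ⁻
  K : ℕ
  K = k !
  B : ℕ
  B = binom a k
  Z : ℕ
  Z = c * c * (16 * (d * d)) * (K * K)
  square : ∀ c K d F → (c * K * (4 * d) * F) * (c * K * (4 * d) * F) ≡ c * c * (16 * (d * d)) * (K * K) * (F * F)
  square = solve-∀
  swap-square : ∀ x y → (x * x) * (y * y) ≡ (y * x) * (y * x)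
  swap-square = solve-∀
  B*K≤a^k : B * K ≤ a ^ k
  B*K≤a^k = ≤-trans (≤-reflexive (binom*k!≡n↓k a k)) (n↓k≤n^k a k)
  Z*2^k≤b^2k : Z * 2 ^ k ≤ b ^ (2 * k)
  Z*2^k≤b^2k = *-cancelʳ-≤ (Z * 2 ^ k) (b ^ (2 * k)) (a ^ k * a ^ k)
                           {{m*n≢0 (a ^ k) (a ^ k) {{m^n≢0 a k}} {{m^n≢0 a k}}}} (begin
    Z * 2 ^ k * (a ^ k * a ^ k)                            ≡⟨ cong (Z * 2 ^ k *_) (^-double a k) ⟨
    Z * 2 ^ k * a ^ (2 * k)                                ≡⟨ move (c * c * (16 * (d * d))) (K * K) (2 ^ k) (a ^ (2 * k)) ⟩
    c * c * (16 * (d * d)) * a ^ (2 * k) * 2 ^ k * (K * K)  ≤⟨ *-monoˡ-≤ (K * K) dense ⟩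
    B * B * b ^ (2 * k) * (K * K)                          ≡⟨ regroup B (b ^ (2 * k)) K ⟩
    b ^ (2 * k) * ((B * K) * (B * K))                      ≤⟨ *-monoʳ-≤ (b ^ (2 * k)) (*-mono-≤ B*K≤a^k B*K≤a^k) ⟩
    b ^ (2 * k) * (a ^ k * a ^ k)                          ∎)
    where
    move : ∀ x y t s → x * y * t * s ≡ x * s * t * y
    move = solve-∀
    regroup : ∀ x y z → x * x * y * (z * z) ≡ y * ((x * z) * (x * z))
    regroup = solve-∀

spoiling-lll-condition : ∀ {c d b n k β γ M} .{{_ : NonZero d}} → 32 * n ≤ b → 8 < b → β ≤ d → γ ≤ k * n →
  c * (4 * d) * 4 ^ k ≤ 3 ^ k * M →
  c * (2 * d) * ((2 * d) ^ β * b ^ γ) ≤ 1 * ((2 * d ∸ 1) ^ β * (b ∸ 8) ^ γ) * M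
spoiling-lll-condition {c} {d} {b} {n} {k} {β} {γ} {M} 32n≤b 8<b β≤d γ≤kn small =
  *-cancelʳ-≤ _ _ (3 ^ k) {{m^n≢0 3 k}} (begin
    c * (2 * d) * (x * y) * 3 ^ k           ≡⟨ regroup₁ c (2 * d) x y (3 ^ k) ⟩
    c * (2 * d) * x * (3 ^ k * y)           ≤⟨ *-mono-≤ (*-monoʳ-≤ (c * (2 * d)) (2d^m≤2*[2d∸1]^m β≤d))
                                                        (3^k*b^m≤4^k*[b∸8]^m {n = n} {k = k} 32n≤b 8<b γ≤kn) ⟩
    c * (2 * d) * (2 * x′) * (4 ^ k * y′)   ≡⟨ regroup₂ c d x′ (4 ^ k) y′ ⟩
    c * (4 * d) * 4 ^ k * (x′ * y′)         ≤⟨ *-monoˡ-≤ (x′ * y′) small ⟩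
    3 ^ k * M * (x′ * y′)                   ≡⟨ regroup₃ (3 ^ k) M x′ y′ ⟩
    1 * (x′ * y′) * M * 3 ^ k               ∎)
  where
  open ≤-Reasoning
  x : ℕ
  x = (2 * d) ^ β
  y : ℕ
  y = b ^ γ
  x′ : ℕ
  x′ = (2 * d ∸ 1) ^ β
  y′ : ℕ
  y′ = (b ∸ 8) ^ γ
  regroup₁ : ∀ c e x y t → c * e * (x * y) * t ≡ c * e * x * (t * y)
  regroup₁ = solve-∀
  regroup₂ : ∀ c d x f y → c * (2 * d) * (2 * x) * (f * y) ≡ c * (4 * d) * f * (x * y)
  regroup₂ = solve-∀
  regroup₃ : ∀ t m x y → t * m * (x * y) ≡ 1 * (x * y) * m * t
  regroup₃ = solve-∀

collision-lll-condition : ∀ {c d Δ b n β γ M} .{{_ : NonZero d}} →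
  32 * n ≤ b → 8 < b → Δ ≤ d → β ≤ 2 * Δ → γ ≤ 2 * n →
  c * b ≤ M →
  c * b * ((2 * d) ^ β * b ^ γ) ≤ 8 * ((2 * d ∸ 1) ^ β * (b ∸ 8) ^ γ) * M
collision-lll-condition {c} {d} {Δ} {b} {n} {β} {γ} {M} 32n≤b 8<b Δ≤d β≤2Δ γ≤2n small = begin
  c * b * ((2 * d) ^ β * b ^ γ)
    ≤⟨ *-mono-≤ small (*-mono-≤ (2d^m≤4*[2d∸1]^m Δ≤d β≤2Δ) (b^m≤2*[b∸8]^m {n = n} 32n≤b 8<b γ≤2n)) ⟩
  M * ((4 * x′) * (2 * y′))
    ≡⟨ regroup M x′ y′ ⟩
  8 * (x′ * y′) * M ∎
  where
  open ≤-Reasoning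
  x′ : ℕ
  x′ = (2 * d ∸ 1) ^ β
  y′ : ℕ
  y′ = (b ∸ 8) ^ γ
  regroup : ∀ m x y → m * ((4 * x) * (2 * y)) ≡ 8 * (x * y) * m
  regroup = solve-∀

∣∣≡∑ : ∀ {n} (S : Subset n) → ∣ S ∣ ≡ ∑[ x < n ] ⟦ lookup S x ⟧
∣∣≡∑ [] = refl
∣∣≡∑ (true ∷ S) = cong suc (∣∣≡∑ S)
∣∣≡∑ (false ∷ S) = ∣∣≡∑ S

does≡true⇒ : ∀ {P : Set} (P? : Dec P) → does P? ≡ true → P
does≡true⇒ (yes p) _ = p

InjectiveOn : ∀ {m a} → Subset m → (Fin m → Fin a) → Set
InjectiveOn N φ = ∀ u u′ → lookup N u ≡ true → lookup N u′ ≡ true → φ u ≡ φ u′ → u ≡ u′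

injectiveOn? : ∀ {m a} (N : Subset m) (φ : Fin m → Fin a) → Dec (InjectiveOn N φ)
injectiveOn? N φ = all? λ u → all? λ u′ →
  (lookup N u Bool.≟ true) →-dec (lookup N u′ Bool.≟ true) →-dec (φ u ≟ φ u′) →-dec (u ≟ u′)

module _ {m a : ℕ} (N : Subset m) where

  InjectiveOn-cong : ∀ {φ ψ : Fin m → Fin a} → (∀ u → lookup N u ≡ true → φ u ≡ ψ u) →
    does (injectiveOn? N φ) ≡ does (injectiveOn? N ψ)
  InjectiveOn-cong φ≈ψ = does-⇔ (mk⇔ (transport φ≈ψ) (transport (λ u Nu → sym (φ≈ψ u Nu))))
                                 (injectiveOn? N _) (injectiveOn? N _)
    where
    transport : ∀ {φ ψ : Fin m → Fin a} → (∀ u → lookup N u ≡ true → φ u ≡ ψ u) →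
      InjectiveOn N φ → InjectiveOn N ψ
    transport φ≈ψ φ-inj u u′ Nu Nu′ ψu≡ψu′ =
      φ-inj u u′ Nu Nu′ (trans (φ≈ψ u Nu) (trans ψu≡ψu′ (sym (φ≈ψ u′ Nu′))))

  ∈image? : ∀ (φ : Fin m → Fin a) x → Dec (∃ λ u → lookup N u ≡ true × φ u ≡ x)
  ∈image? φ x = any? (λ u → (lookup N u Bool.≟ true) ×-dec (φ u ≟ x))

  image-lookup : ∀ (φ : Fin m → Fin a) x → lookup (image φ N) x ≡ does (∈image? φ x)
  image-lookup φ x = lookup∘tabulate (λ y → does (∈image? φ y)) x

  image-∋⁻ : ∀ (φ : Fin m → Fin a) x → lookup (image φ N) x ≡ true → ∃ λ u → lookup N u ≡ true × φ u ≡ x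
  image-∋⁻ φ x x∈img = does≡true⇒ (∈image? φ x) (trans (sym (image-lookup φ x)) x∈img)

  image-∋ : ∀ (φ : Fin m → Fin a) u → lookup N u ≡ true → lookup (image φ N) (φ u) ≡ true
  image-∋ φ u Nu = trans (image-lookup φ (φ u)) (dec-true (∈image? φ (φ u)) (u , Nu , refl))

  image-cong : ∀ {φ ψ : Fin m → Fin a} → (∀ u → lookup N u ≡ true → φ u ≡ ψ u) → image φ N ≡ image ψ N
  image-cong {φ} {ψ} φ≈ψ = tabulate-cong (λ x →
    does-⇔ (mk⇔ (λ (u , Nu , φu≡x) → u , Nu , trans (sym (φ≈ψ u Nu)) φu≡x)
                (λ (u , Nu , ψu≡x) → u , Nu , trans (φ≈ψ u Nu) ψu≡x))
           (∈image? φ x) (∈image? ψ x))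

  ⟦image⟧≡∑ : ∀ {φ : Fin m → Fin a} → InjectiveOn N φ → ∀ x →
    ⟦ lookup (image φ N) x ⟧ ≡ ∑[ u < m ] ⟦ lookup N u ∧ does (x ≟ φ u) ⟧
  ⟦image⟧≡∑ {φ} φ-inj x with lookup (image φ N) x in x∈img
  ... | true with u , Nu , φu≡x ← image-∋⁻ φ x x∈img =
    ≤-antisym (≤-trans (≤-reflexive (cong ⟦_⟧ (sym hit)))
                       (term≤∑ (λ u′ → ⟦ lookup N u′ ∧ does (x ≟ φ u′) ⟧) u))
              (∑⟦⟧≤1 (λ u′ → lookup N u′ ∧ does (x ≟ φ u′)) unique)
    where
    hit : lookup N u ∧ does (x ≟ φ u) ≡ true
    hit rewrite Nu = dec-true (x ≟ φ u) (sym φu≡x)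
    unique : ∀ u′ u″ → lookup N u′ ∧ does (x ≟ φ u′) ≡ true → lookup N u″ ∧ does (x ≟ φ u″) ≡ true →
      u′ ≡ u″
    unique u′ u″ p′ p″ with lookup N u′ in Nu′ | lookup N u″ in Nu″ | x ≟ φ u′ | x ≟ φ u″
    ... | true | true | yes x≡φu′ | yes x≡φu″ = φ-inj u′ u″ Nu′ Nu″ (trans (sym x≡φu′) x≡φu″)
  ... | false = sym (∑-zero miss)
    where
    miss : ∀ u → ⟦ lookup N u ∧ does (x ≟ φ u) ⟧ ≡ 0
    miss u with lookup N u in Nu | x ≟ φ u
    ... | false | _ = refl
    ... | true | no _ = refl
    ... | true | yes refl with () ← trans (sym x∈img) (image-∋ φ u Nu)

  ∣image∣≡∣N∣ : ∀ {φ : Fin m → Fin a} → InjectiveOn N φ → ∣ image φ N ∣ ≡ ∣ N ∣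
  ∣image∣≡∣N∣ {φ} φ-inj = begin
    ∣ image φ N ∣
      ≡⟨ ∣∣≡∑ (image φ N) ⟩
    ∑[ x < a ] ⟦ lookup (image φ N) x ⟧
      ≡⟨ sum-cong-≗ (⟦image⟧≡∑ φ-inj) ⟩
    ∑[ x < a ] ∑[ u < m ] ⟦ lookup N u ∧ does (x ≟ φ u) ⟧
      ≡⟨ ∑-comm (λ x u → ⟦ lookup N u ∧ does (x ≟ φ u) ⟧) ⟩
    ∑[ u < m ] ∑[ x < a ] ⟦ lookup N u ∧ does (x ≟ φ u) ⟧
      ≡⟨ sum-cong-≗ (λ u → sum-cong-≗ (λ x → ⟦∧⟧ (lookup N u) (does (x ≟ φ u)))) ⟩
    ∑[ u < m ] ∑[ x < a ] (⟦ lookup N u ⟧ * ⟦ does (x ≟ φ u) ⟧)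
      ≡⟨ sum-cong-≗ (λ u → *-distribˡ-sum ⟦ lookup N u ⟧ (λ x → ⟦ does (x ≟ φ u) ⟧)) ⟨
    ∑[ u < m ] (⟦ lookup N u ⟧ * ∑[ x < a ] ⟦ does (x ≟ φ u) ⟧)
      ≡⟨ sum-cong-≗ (λ u → cong (⟦ lookup N u ⟧ *_) (∑-indicator≡1 (φ u))) ⟩
    ∑[ u < m ] (⟦ lookup N u ⟧ * 1)
      ≡⟨ sum-cong-≗ (λ u → *-identityʳ ⟦ lookup N u ⟧) ⟩
    ∑[ u < m ] ⟦ lookup N u ⟧
      ≡⟨ ∣∣≡∑ N ⟨
    ∣ N ∣ ∎
    where open ≡-Reasoning

-- Counting the bad events

allSubsets-complete : ∀ m (S : Subset m) → S ∈ˡ allSubsets m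
allSubsets-complete zero [] = here refl
allSubsets-complete (suc m) (true ∷ S) = ∈-++⁺ˡ (∈-map⁺ (true ∷_) (allSubsets-complete m S))
allSubsets-complete (suc m) (false ∷ S) =
  ∈-++⁺ʳ (map (true ∷_) (allSubsets m)) (∈-map⁺ (false ∷_) (allSubsets-complete m S))

lookup-remove : ∀ {m} (S : Subset m) {x y} → lookup S y ≡ true → y ≢ x → lookup (S - x) y ≡ true
lookup-remove S {y = y} Sy y≢x = []=⇒lookup (x∈p∧x≢y⇒x∈p-y (lookup⇒[]= y S Sy) y≢x)

∣S-x∣≤pred∣S∣ : ∀ {m} (S : Subset m) {x} → lookup S x ≡ true → ∣ S - x ∣ ≤ pred ∣ S ∣
∣S-x∣≤pred∣S∣ S {x} Sx = <⇒≤pred (x∈p⇒∣p-x∣<∣p∣ (lookup⇒[]= x S Sx))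

module _ {a b : ℕ} where

  -- u ↦ e u (ω u) maps N injectively into S, decided one coordinate at a time by removing each
  -- image point from S, which is the form in which it can be counted.
  injectsInto : ∀ {n} → (Fin n → Fin b → Fin a) → Subset n → Subset a → Vec (Fin b) n → Bool
  injectsInto e [] S [] = true
  injectsInto e (true ∷ N) S (c ∷ ω) = lookup S (e zero c) ∧ injectsInto (e ∘ suc) N (S - e zero c) ω
  injectsInto e (false ∷ N) S (c ∷ ω) = injectsInto (e ∘ suc) N S ω

  injectsInto-complete : ∀ {n} (e : Fin n → Fin b → Fin a) N S (ω : Vec (Fin b) n) →
    (∀ u → lookup N u ≡ true → lookup S (e u (lookup ω u)) ≡ true) →
    InjectiveOn N (λ u → e u (lookup ω u)) → injectsInto e N S ω ≡ true
  injectsInto-complete e [] S [] _ _ = refl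
  injectsInto-complete e (false ∷ N) S (c ∷ ω) into inj =
    injectsInto-complete (e ∘ suc) N S ω (into ∘ suc)
      (λ u u′ Nu Nu′ eq → FinP.suc-injective (inj (suc u) (suc u′) Nu Nu′ eq))
  injectsInto-complete e (true ∷ N) S (c ∷ ω) into inj rewrite into zero refl =
    injectsInto-complete (e ∘ suc) N (S - e zero c) ω
      (λ u Nu → lookup-remove S (into (suc u) Nu) (λ eq → FinP.0≢1+n (inj zero (suc u) refl Nu (sym eq))))
      (λ u u′ Nu Nu′ eq → FinP.suc-injective (inj (suc u) (suc u′) Nu Nu′ eq))

  -- The first vertex of N has at most |S| admissible values, each leaving a set with one point fewer.
  count-injectsInto : ∀ {n} (e : Fin n → Fin b → Fin a) → (∀ u → Injective _≡_ _≡_ (e u)) → ∀ N S →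
    count n (injectsInto e N S) * b ^ ∣ N ∣ ≤ ∣ S ∣ ↓ ∣ N ∣ * b ^ n
  count-injectsInto {zero} e e-inj [] S = ≤-refl
  count-injectsInto {suc n} e e-inj (false ∷ N) S = begin
    (∑[ c < b ] X) * b ^ k       ≡⟨ cong (_* b ^ k) (∑-const b X) ⟩
    b * X * b ^ k                ≡⟨ *-assoc b X (b ^ k) ⟩
    b * (X * b ^ k)              ≤⟨ *-monoʳ-≤ b (count-injectsInto (e ∘ suc) (e-inj ∘ suc) N S) ⟩
    b * (∣ S ∣ ↓ k * b ^ n)      ≡⟨ x*[y*z]≡y*[x*z] b (∣ S ∣ ↓ k) (b ^ n) ⟩
    ∣ S ∣ ↓ k * (b * b ^ n)      ∎
    where
    open ≤-Reasoning
    k : ℕ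
    k = ∣ N ∣
    X : ℕ
    X = count n (injectsInto (e ∘ suc) N S)
    x*[y*z]≡y*[x*z] : ∀ x y z → x * (y * z) ≡ y * (x * z)
    x*[y*z]≡y*[x*z] = solve-∀
  count-injectsInto {suc n} e e-inj (true ∷ N) S = begin
    (∑[ c < b ] ∑Ω n (λ ω → ⟦ s c ∧ injectsInto (e ∘ suc) N (S - e zero c) ω ⟧)) * (b * b ^ k)
      ≡⟨ cong (_* (b * b ^ k)) (sum-cong-≗ (λ c →
           trans (∑Ω-cong n (λ ω → ⟦∧⟧ (s c) _)) (sym (*-distribˡ-∑Ω n ⟦ s c ⟧ _)))) ⟩
    (∑[ c < b ] (⟦ s c ⟧ * Y c)) * (b * b ^ k)
      ≡⟨ x*[y*z]≡y*[x*z] (∑[ c < b ] (⟦ s c ⟧ * Y c)) b (b ^ k) ⟩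
    b * ((∑[ c < b ] (⟦ s c ⟧ * Y c)) * b ^ k)
      ≡⟨ cong (b *_) (*-distribʳ-sum (b ^ k) (λ c → ⟦ s c ⟧ * Y c)) ⟩
    b * ∑[ c < b ] (⟦ s c ⟧ * Y c * b ^ k)
      ≤⟨ *-monoʳ-≤ b (∑-mono-≤ term) ⟩
    b * ∑[ c < b ] (⟦ s c ⟧ * F)
      ≡⟨ cong (b *_) (*-distribʳ-sum F (λ c → ⟦ s c ⟧)) ⟨
    b * ((∑[ c < b ] ⟦ s c ⟧) * F)
      ≤⟨ *-monoʳ-≤ b (*-monoˡ-≤ F (≤-trans (∑∘injective≤∑ (e zero) (e-inj zero) (λ x → ⟦ lookup S x ⟧))
                                            (≤-reflexive (sym (∣∣≡∑ S))))) ⟩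
    b * (∣ S ∣ * F)
      ≡⟨ rearrange b ∣ S ∣ (pred ∣ S ∣ ↓ k) (b ^ n) ⟩
    ∣ S ∣ * pred ∣ S ∣ ↓ k * (b * b ^ n) ∎
    where
    open ≤-Reasoning
    k : ℕ
    k = ∣ N ∣
    s : Fin b → Bool
    s c = lookup S (e zero c)
    Y : Fin b → ℕ
    Y c = count n (injectsInto (e ∘ suc) N (S - e zero c))
    F : ℕ
    F = pred ∣ S ∣ ↓ k * b ^ n
    x*[y*z]≡y*[x*z] : ∀ x y z → x * (y * z) ≡ y * (x * z)
    x*[y*z]≡y*[x*z] = solve-∀
    rearrange : ∀ b s y z → b * (s * (y * z)) ≡ s * y * (b * z)
    rearrange = solve-∀
    term : ∀ c → ⟦ s c ⟧ * Y c * b ^ k ≤ ⟦ s c ⟧ * F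
    term c with s c in Se₀c
    ... | false = z≤n
    ... | true = begin
      (Y c + 0) * b ^ k                 ≡⟨ cong (_* b ^ k) (+-identityʳ (Y c)) ⟩
      Y c * b ^ k                       ≤⟨ count-injectsInto (e ∘ suc) (e-inj ∘ suc) N (S - e zero c) ⟩
      ∣ S - e zero c ∣ ↓ k * b ^ n       ≤⟨ *-monoˡ-≤ (b ^ n) (↓-monoˡ-≤ k (∣S-x∣≤pred∣S∣ S Se₀c)) ⟩
      F                                 ≡⟨ +-identityʳ F ⟨
      F + 0                             ∎

module Assignment {n a b : ℕ} (e : Fin n → Fin b → Fin a) (e-inj : ∀ u → Injective _≡_ _≡_ (e u)) where

  assign : Vec (Fin b) n → Fin n → Fin a
  assign ω u = e u (lookup ω u)

  -- Injectivity on N is part of the event so that φ(N) lies on the level |N| of 𝓕 that the density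
  -- hypothesis controls.
  spoils : Family a → Subset n → Vec (Fin b) n → Bool
  spoils 𝓕 N ω = 𝓕 (image (assign ω) N) ∧ does (injectiveOn? N (assign ω))

  spoils-local : ∀ 𝓕 N → DependsOn (lookup N) (spoils 𝓕 N)
  spoils-local 𝓕 N ω ω′ ω≈ω′ = cong₂ (λ S t → 𝓕 S ∧ t) (image-cong N agree) (InjectiveOn-cong N agree)
    where
    agree : ∀ u → lookup N u ≡ true → assign ω u ≡ assign ω′ u
    agree u Nu = cong (e u) (ω≈ω′ u Nu)

  module _ (𝓕 : Family a) (N : Subset n) where

    onLevel : Subset a → Bool
    onLevel S = (∣ S ∣ ≡ᵇ ∣ N ∣) ∧ 𝓕 S

    level : List (Subset a)
    level = filterᵇ onLevel (allSubsets a)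

    spoils≤∑injectsInto : ∀ ω →
      ⟦ spoils 𝓕 N ω ⟧ ≤ ∑[ i < length level ] ⟦ injectsInto e N (List.lookup level i) ω ⟧
    spoils≤∑injectsInto ω with 𝓕 (image (assign ω) N) in 𝓕img
    ... | false = z≤n
    ... | true = bound (injectiveOn? N (assign ω))
      where
      img : Subset a
      img = image (assign ω) N
      bound : (inj? : Dec (InjectiveOn N (assign ω))) →
        ⟦ does inj? ⟧ ≤ ∑[ i < length level ] ⟦ injectsInto e N (List.lookup level i) ω ⟧
      bound (no _) = z≤n
      bound (yes inj) = ≤-trans (≤-reflexive (cong ⟦_⟧ (sym into-img)))
                                (term≤∑ (λ i → ⟦ injectsInto e N (List.lookup level i) ω ⟧) i)
        where
        img∈level : img ∈ˡ level
        img∈level = ∈-filter⁺ (T? ∘ onLevel) (allSubsets-complete a img)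
                      (Equivalence.from T-∧ (≡⇒≡ᵇ _ ∣ N ∣ (∣image∣≡∣N∣ N inj) , subst T (sym 𝓕img) _))
        i : Fin (length level)
        i = index img∈level
        into-img : injectsInto e N (List.lookup level i) ω ≡ true
        into-img rewrite sym (lookup-index img∈level) =
          injectsInto-complete e N img ω (λ u Nu → image-∋ N (assign ω) u Nu) inj

    count-injectsInto-level : ∀ i → count n (injectsInto e N (List.lookup level i)) * b ^ ∣ N ∣ ≤ ∣ N ∣ ! * b ^ n
    count-injectsInto-level i = begin
      count n (injectsInto e N S) * b ^ k   ≤⟨ count-injectsInto e e-inj N S ⟩
      ∣ S ∣ ↓ k * b ^ n                     ≡⟨ cong (λ j → j ↓ k * b ^ n) ∣S∣≡k ⟩
      k ↓ k * b ^ n                         ≡⟨ cong (_* b ^ n) (n↓n≡n! k) ⟩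
      k ! * b ^ n                           ∎
      where
      open ≤-Reasoning
      k : ℕ
      k = ∣ N ∣
      S : Subset a
      S = List.lookup level i
      ∣S∣≡k : ∣ S ∣ ≡ k
      ∣S∣≡k = ≡ᵇ⇒≡ _ k (proj₁ (Equivalence.to T-∧
                (proj₂ (∈-filter⁻ (T? ∘ onLevel) {xs = allSubsets a} (∈-lookup i)))))

    count-spoils : count n (spoils 𝓕 N) * b ^ ∣ N ∣ ≤ levelCount 𝓕 ∣ N ∣ * ∣ N ∣ ! * b ^ n
    count-spoils = begin
      count n (spoils 𝓕 N) * b ^ k                     ≤⟨ *-monoˡ-≤ (b ^ k) (∑Ω-mono-≤ n spoils≤∑injectsInto) ⟩
      ∑Ω n (λ ω → ∑[ i < length level ] ⟦ into i ω ⟧) * b ^ k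
                                                       ≡⟨ cong (_* b ^ k) (∑Ω-comm-∑ n (λ i ω → ⟦ into i ω ⟧)) ⟩
      (∑[ i < length level ] count n (into i)) * b ^ k ≡⟨ *-distribʳ-sum (b ^ k) (λ i → count n (into i)) ⟩
      ∑[ i < length level ] (count n (into i) * b ^ k) ≤⟨ ∑-mono-≤ count-injectsInto-level ⟩
      ∑[ i < length level ] (k ! * b ^ n)              ≡⟨ ∑-const (length level) (k ! * b ^ n) ⟩
      length level * (k ! * b ^ n)                     ≡⟨ *-assoc (length level) (k !) (b ^ n) ⟨
      levelCount 𝓕 k * k ! * b ^ n                     ∎
      where
      open ≤-Reasoning
      k : ℕ
      k = ∣ N ∣
      into : Fin (length level) → Vec (Fin b) n → Bool
      into i = injectsInto e N (List.lookup level i)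

  collides : Fin n → Fin n → Vec (Fin b) n → Bool
  collides u w ω = does (assign ω u ≟ assign ω w)

  count-collides : ∀ {u w} → u ≢ w → count n (collides u w) * b ≤ b ^ n
  count-collides {u} {w} u≢w = count*b≤b^n w (collides u w) unique
    where
    collision-value : ∀ ω c → collides u w (ω [ w ]≔ c) ≡ true → e w c ≡ assign ω u
    collision-value ω c hit with assign (ω [ w ]≔ c) u ≟ assign (ω [ w ]≔ c) w
    ... | yes eq = trans (sym (trans eq (cong (e w) (lookup∘update w ω c)))) (cong (e u) (lookup∘update′ u≢w ω c))
    unique : ∀ ω c c′ → collides u w (ω [ w ]≔ c) ≡ true → collides u w (ω [ w ]≔ c′) ≡ true → c ≡ c′
    unique ω c c′ hit hit′ = e-inj w (trans (collision-value ω c hit) (sym (collision-value ω c′ hit′)))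

subset-embedding : ∀ {a} (S : Subset a) {k} → k ≤ ∣ S ∣ →
  Σ (Fin k → Fin a) (λ e → Injective _≡_ _≡_ e × (∀ c → lookup S (e c) ≡ true))
subset-embedding [] {zero} _ = (λ ()) , (λ { {()} }) , (λ ())
subset-embedding (false ∷ S) k≤∣S∣ with e , e-inj , e∈S ← subset-embedding S k≤∣S∣ =
  suc ∘ e , e-inj ∘ FinP.suc-injective , e∈S
subset-embedding (true ∷ S) {zero} _ = (λ ()) , (λ { {()} }) , (λ ())
subset-embedding (true ∷ S) {suc k} (s≤s k≤∣S∣) with e , e-inj , e∈S ← subset-embedding S k≤∣S∣ =
  e′ , e′-inj , e′∈S
  where
  e′ : Fin (suc k) → Fin _
  e′ zero = zero
  e′ (suc c) = suc (e c)
  e′-inj : Injective _≡_ _≡_ e′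
  e′-inj {zero} {zero} _ = refl
  e′-inj {suc c} {suc c′} eq = cong suc (e-inj (FinP.suc-injective eq))
  e′∈S : ∀ c → lookup (true ∷ S) (e′ c) ≡ true
  e′∈S zero = refl
  e′∈S (suc c) = e∈S c

module Construction
  {n₁ n₂ : ℕ} (D : BipGraph n₁ n₂) {Δ⁺ Δ⁻ : ℕ} (1≤Δ⁺ : 1 ≤ Δ⁺) (1≤Δ⁻ : 1 ≤ Δ⁻)
  (deg⁺ : ∀ u → ∣ N₁ D u ∣ ≤ Δ⁺) (deg⁻ : ∀ v → ∣ N₂ D v ∣ ≤ Δ⁻)
  {a b : ℕ} (8<b : 8 < b) (32n₁≤b : 32 * n₁ ≤ b) (b≤a : b ≤ a)
  (𝓕 : Fin n₂ → Family a) (dense : ∀ v → DensityBound Δ⁺ Δ⁻ b ∣ N₂ D v ∣ (𝓕 v))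
  (f : Fin n₁ → Subset a) (large : ∀ u → b ≤ ∣ f u ∣)
  where

  d : ℕ
  d = Δ⁺ * Δ⁻

  instance
    d≢0 : NonZero d
    d≢0 = >-nonZero (*-mono-≤ 1≤Δ⁺ 1≤Δ⁻)
    b≢0 : NonZero b
    b≢0 = >-nonZero (m<n⇒0<n 8<b)
    a≢0 : NonZero a
    a≢0 = >-nonZero (≤-trans (m<n⇒0<n 8<b) b≤a)

  e : Fin n₁ → Fin b → Fin a
  e u = proj₁ (subset-embedding (f u) (large u))

  e-inj : ∀ u → Injective _≡_ _≡_ (e u)
  e-inj u = proj₁ (proj₂ (subset-embedding (f u) (large u)))

  e∈f : ∀ u c → lookup (f u) (e u c) ≡ true
  e∈f u = proj₂ (proj₂ (subset-embedding (f u) (large u)))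

  open Assignment e e-inj

  Event : Set
  Event = Fin n₂ ⊎ (Fin n₁ × Fin n₁)

  -- There is a collision event for every pair (u , w), but it is empty, with empty support, unless u < w.
  support : Event → Fin n₁ → Bool
  support (inj₁ v) = lookup (N₂ D v)
  support (inj₂ (u , w)) z = does (u <? w) ∧ (does (z ≟ u) ∨ does (z ≟ w))

  bad : Event → Vec (Fin b) n₁ → Bool
  bad (inj₁ v) = spoils (𝓕 v) (N₂ D v)
  bad (inj₂ (u , w)) ω = does (u <? w) ∧ collides u w ω

  bad-local : ∀ i → DependsOn (support i) (bad i)
  bad-local (inj₁ v) = spoils-local (𝓕 v) (N₂ D v)
  bad-local (inj₂ (u , w)) ω ω′ ω≈ω′ =
    guard (does (u <? w)) (λ u<w →
      cong₂ (λ x y → does (e u x ≟ e w y)) (ω≈ω′ u (u∈V u<w)) (ω≈ω′ w (w∈V u<w)))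
    where
    guard : ∀ s {x y : Bool} → (s ≡ true → x ≡ y) → s ∧ x ≡ s ∧ y
    guard false _ = refl
    guard true x≡y = x≡y refl
    u∈V : does (u <? w) ≡ true → support (inj₂ (u , w)) u ≡ true
    u∈V u<w = trans (cong (_∧ (does (u ≟ u) ∨ does (u ≟ w))) u<w)
                    (cong (_∨ does (u ≟ w)) (dec-true (u ≟ u) refl))
    w∈V : does (u <? w) ≡ true → support (inj₂ (u , w)) w ≡ true
    w∈V u<w = trans (cong (_∧ (does (w ≟ u) ∨ does (w ≟ w))) u<w)
                    (trans (cong (does (w ≟ u) ∨_) (dec-true (w ≟ w) refl)) (∨-zeroʳ _))

  pairs : List (Fin n₁ × Fin n₁)
  pairs = cartesianProduct (allFin n₁) (allFin n₁)

  events : List Event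
  events = map inj₁ (allFin n₂) ++ map inj₂ pairs

  events! : Unique events
  events! = Unique.++⁺ (Unique.map⁺ inj₁-injective (Unique.allFin⁺ n₂))
                       (Unique.map⁺ inj₂-injective (Unique.cartesianProduct⁺ (Unique.allFin⁺ n₁) (Unique.allFin⁺ n₁)))
                       disjoint
    where
    disjoint : ∀ {i} → i ∈ˡ map inj₁ (allFin n₂) × i ∈ˡ map inj₂ pairs → ⊥
    disjoint (i∈₁ , i∈₂) with ∈-map⁻ inj₁ i∈₁ | ∈-map⁻ inj₂ i∈₂
    ... | _ , _ , refl | _ , _ , ()

  spoiling∈events : ∀ v → inj₁ v ∈ˡ events
  spoiling∈events v = ∈-++⁺ˡ (∈-map⁺ inj₁ (∈-allFin v))

  collision∈events : ∀ u w → inj₂ (u , w) ∈ˡ events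
  collision∈events u w =
    ∈-++⁺ʳ (map inj₁ (allFin n₂)) (∈-map⁺ inj₂ (∈-cartesianProduct⁺ (∈-allFin u) (∈-allFin w)))

  p q : Event → ℕ
  p (inj₁ _) = 1
  p (inj₂ _) = 8
  q (inj₁ _) = 2 * d
  q (inj₂ _) = b

  p<q : ∀ i → p i < q i
  p<q (inj₁ _) = *-monoʳ-≤ 2 (>-nonZero⁻¹ d)
  p<q (inj₂ _) = 8<b

  open LovaszLocalLemma events bad support bad-local p q p<q

  β γ : Event → ℕ
  β i = ∑[ v < n₂ ] ⟦ adjacent i (inj₁ v) ⟧
  γ i = ∑[ u < n₁ ] ∑[ w < n₁ ] ⟦ adjacent i (inj₂ (u , w)) ⟧

  ∏-neighbours : ∀ (g : Event → ℕ) {α α′} → (∀ v → g (inj₁ v) ≡ α) → (∀ x → g (inj₂ x) ≡ α′) →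
    ∀ i → ∏ g (neighbours i) ≡ α ^ β i * α′ ^ γ i
  ∏-neighbours g {α} {α′} g₁ g₂ i = begin
    ∏ g (filterᵇ (adjacent i) events)
      ≡⟨ cong (∏ g) (filter-++ (T? ∘ adjacent i) (map inj₁ (allFin n₂)) (map inj₂ pairs)) ⟩
    ∏ g (filterᵇ (adjacent i) (map inj₁ (allFin n₂)) ++ filterᵇ (adjacent i) (map inj₂ pairs))
      ≡⟨ ∏-++ g (filterᵇ (adjacent i) (map inj₁ (allFin n₂))) _ ⟩
    ∏ g (filterᵇ (adjacent i) (map inj₁ (allFin n₂))) * ∏ g (filterᵇ (adjacent i) (map inj₂ pairs))
      ≡⟨ cong₂ _*_ (∏-filterᵇ-map g (adjacent i) inj₁ g₁ (allFin n₂))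
                   (∏-filterᵇ-map g (adjacent i) inj₂ g₂ pairs) ⟩
    α ^ length (filterᵇ (adjacent i ∘ inj₁) (allFin n₂)) * α′ ^ length (filterᵇ (adjacent i ∘ inj₂) pairs)
      ≡⟨ cong₂ (λ s t → α ^ s * α′ ^ t) (length-filterᵇ-tabulate (adjacent i ∘ inj₁) (λ v → v))
                                         (length-filterᵇ-allPairs (adjacent i ∘ inj₂)) ⟩
    α ^ β i * α′ ^ γ i ∎
    where open ≡-Reasoning

  spoiling-degree : ∀ z → ∑[ v < n₂ ] ⟦ support (inj₁ v) z ⟧ ≤ Δ⁺
  spoiling-degree z = begin
    ∑[ v < n₂ ] ⟦ lookup (N₂ D v) z ⟧    ≡⟨ sum-cong-≗ (λ v → cong ⟦_⟧ (trans (lookup∘tabulate (λ u → D u v) z)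
                                                                         (sym (lookup∘tabulate (D z) v)))) ⟩
    ∑[ v < n₂ ] ⟦ lookup (N₁ D z) v ⟧    ≡⟨ ∣∣≡∑ (N₁ D z) ⟨
    ∣ N₁ D z ∣                           ≤⟨ deg⁺ z ⟩
    Δ⁺                                   ∎
    where open ≤-Reasoning

  collision-degree : ∀ z → ∑[ u < n₁ ] ∑[ w < n₁ ] ⟦ support (inj₂ (u , w)) z ⟧ ≤ n₁
  collision-degree = ∑∑-ordered-pairs-through≤

  collision-size : ∀ u w → ∑[ z < n₁ ] ⟦ support (inj₂ (u , w)) z ⟧ ≤ 2
  collision-size u w = begin
    ∑[ z < n₁ ] ⟦ does (u <? w) ∧ (does (z ≟ u) ∨ does (z ≟ w)) ⟧
      ≤⟨ ∑-mono-≤ (λ z → ⟦s∧[t∨u]⟧≤⟦t⟧+⟦u⟧ (does (u <? w)) (does (z ≟ u)) (does (z ≟ w))) ⟩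
    ∑[ z < n₁ ] (⟦ does (z ≟ u) ⟧ + ⟦ does (z ≟ w) ⟧)
      ≡⟨ ∑-distrib-+ (λ z → ⟦ does (z ≟ u) ⟧) (λ z → ⟦ does (z ≟ w) ⟧) ⟩
    ∑[ z < n₁ ] ⟦ does (z ≟ u) ⟧ + ∑[ z < n₁ ] ⟦ does (z ≟ w) ⟧
      ≡⟨ cong₂ _+_ (∑-indicator≡1 u) (∑-indicator≡1 w) ⟩
    2 ∎
    where open ≤-Reasoning

  β-bound : ∀ i → β i ≤ ∑[ z < n₁ ] ⟦ support i z ⟧ * Δ⁺
  β-bound i = ∑-meets≤ (support i) (λ v → support (inj₁ v)) spoiling-degree

  γ-bound : ∀ i → γ i ≤ ∑[ z < n₁ ] ⟦ support i z ⟧ * n₁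
  γ-bound i = ∑∑-meets≤ (support i) (λ u w → support (inj₂ (u , w))) collision-degree

  spoiling-size : ∀ v → ∑[ z < n₁ ] ⟦ support (inj₁ v) z ⟧ ≡ ∣ N₂ D v ∣
  spoiling-size v = sym (∣∣≡∑ (N₂ D v))

  β-spoiling : ∀ v → β (inj₁ v) ≤ d
  β-spoiling v = begin
    β (inj₁ v)                                  ≤⟨ β-bound (inj₁ v) ⟩
    ∑[ z < n₁ ] ⟦ support (inj₁ v) z ⟧ * Δ⁺     ≡⟨ cong (_* Δ⁺) (spoiling-size v) ⟩
    ∣ N₂ D v ∣ * Δ⁺                             ≤⟨ *-monoˡ-≤ Δ⁺ (deg⁻ v) ⟩
    Δ⁻ * Δ⁺                                     ≡⟨ *-comm Δ⁻ Δ⁺ ⟩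
    d                                           ∎
    where open ≤-Reasoning

  γ-spoiling : ∀ v → γ (inj₁ v) ≤ ∣ N₂ D v ∣ * n₁
  γ-spoiling v = ≤-trans (γ-bound (inj₁ v)) (≤-reflexive (cong (_* n₁) (spoiling-size v)))

  β-collision : ∀ u w → β (inj₂ (u , w)) ≤ 2 * Δ⁺
  β-collision u w = ≤-trans (β-bound (inj₂ (u , w))) (*-monoˡ-≤ Δ⁺ (collision-size u w))

  γ-collision : ∀ u w → γ (inj₂ (u , w)) ≤ 2 * n₁
  γ-collision u w = ≤-trans (γ-bound (inj₂ (u , w))) (*-monoˡ-≤ n₁ (collision-size u w))

  count-spoiling≤ : ∀ v → count n₁ (bad (inj₁ v)) * (4 * d) * 4 ^ ∣ N₂ D v ∣ ≤ 3 ^ ∣ N₂ D v ∣ * b ^ n₁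
  count-spoiling≤ v = *-cancelʳ-≤ _ _ (b ^ k) {{m^n≢0 b k}} (begin
    c * (4 * d) * 4 ^ k * b ^ k            ≡⟨ regroup₁ c (4 * d) (4 ^ k) (b ^ k) ⟩
    (c * b ^ k) * (4 * d * 4 ^ k)          ≤⟨ *-monoˡ-≤ (4 * d * 4 ^ k) (count-spoils (𝓕 v) (N₂ D v)) ⟩
    (ℓ * k ! * M) * (4 * d * 4 ^ k)        ≡⟨ regroup₂ ℓ (k !) M (4 * d) (4 ^ k) ⟩
    (ℓ * k ! * (4 * d) * 4 ^ k) * M        ≤⟨ *-monoˡ-≤ M (densityBound⇒levelCount≤ Δ⁺ Δ⁻ b k (𝓕 v) (dense v)) ⟩
    (3 ^ k * b ^ k) * M                    ≡⟨ regroup₃ (3 ^ k) (b ^ k) M ⟩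
    3 ^ k * M * b ^ k                      ∎)
    where
    open ≤-Reasoning
    k : ℕ
    k = ∣ N₂ D v ∣
    c : ℕ
    c = count n₁ (bad (inj₁ v))
    ℓ : ℕ
    ℓ = levelCount (𝓕 v) k
    M : ℕ
    M = b ^ n₁
    regroup₁ : ∀ c x y z → c * x * y * z ≡ (c * z) * (x * y)
    regroup₁ = solve-∀
    regroup₂ : ∀ l f m x y → (l * f * m) * (x * y) ≡ (l * f * x * y) * m
    regroup₂ = solve-∀
    regroup₃ : ∀ x y m → (x * y) * m ≡ x * m * y
    regroup₃ = solve-∀

  count-collision≤ : ∀ u w → count n₁ (bad (inj₂ (u , w))) * b ≤ b ^ n₁
  count-collision≤ u w = small (u <? w)
    where
    small : (u<?w : Dec (u Fin.< w)) → count n₁ (λ ω → does u<?w ∧ collides u w ω) * b ≤ b ^ n₁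
    small (yes u<w) = count-collides (FinP.<⇒≢ u<w)
    small (no _) = subst (λ x → x * b ≤ b ^ n₁) (sym (∑Ω-const n₁ 0)) z≤n

  local-lemma-condition : ∀ i → i ∈ˡ events →
    count n₁ (bad i) * q i * ∏ q (neighbours i) ≤ p i * ∏ r (neighbours i) * b ^ n₁
  local-lemma-condition i _ = subst₂ (λ x y → count n₁ (bad i) * q i * x ≤ p i * y * b ^ n₁)
    (sym (∏-neighbours q (λ _ → refl) (λ _ → refl) i)) (sym (∏-neighbours r (λ _ → refl) (λ _ → refl) i))
    (condition i)
    where
    condition : ∀ i → count n₁ (bad i) * q i * ((2 * d) ^ β i * b ^ γ i) ≤
                      p i * ((2 * d ∸ 1) ^ β i * (b ∸ 8) ^ γ i) * b ^ n₁
    condition (inj₁ v) = spoiling-lll-condition {c = count n₁ (bad (inj₁ v))} {n = n₁} {k = ∣ N₂ D v ∣}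
      32n₁≤b 8<b (β-spoiling v) (γ-spoiling v) (count-spoiling≤ v)
    condition (inj₂ (u , w)) = collision-lll-condition {c = count n₁ (bad (inj₂ (u , w)))} {n = n₁}
      32n₁≤b 8<b (m≤m*n Δ⁺ Δ⁻ {{>-nonZero 1≤Δ⁻}}) (β-collision u w) (γ-collision u w) (count-collision≤ u w)

  Good : Vec (Fin b) n₁ → Set
  Good ω = ∀ {i} → i ∈ˡ events → bad i ω ≡ false

  good⇒no-collision : ∀ {ω} → Good ω → ∀ {x y} → x Fin.< y → assign ω x ≢ assign ω y
  good⇒no-collision {ω} good {x} {y} x<y φx≡φy with () ← trans (sym (good (collision∈events x y)))
    (cong₂ _∧_ (dec-true (x <? y) x<y) (dec-true (assign ω x ≟ assign ω y) φx≡φy))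

  good⇒injective : ∀ {ω} → Good ω → Injective _≡_ _≡_ (assign ω)
  good⇒injective good {x} {y} φx≡φy with FinP.<-cmp x y
  ... | tri< x<y _ _ = contradiction φx≡φy (good⇒no-collision good x<y)
  ... | tri≈ _ x≡y _ = x≡y
  ... | tri> _ _ y<x = contradiction (sym φx≡φy) (good⇒no-collision good y<x)

  good⇒unspoiled : ∀ {ω} → Good ω → ∀ v → 𝓕 v (image (assign ω) (N₂ D v)) ≡ false
  good⇒unspoiled {ω} good v = first-false (good (spoiling∈events v))
    (dec-true (injectiveOn? (N₂ D v) (assign ω)) (λ _ _ _ _ → good⇒injective good))
    where
    first-false : ∀ {s t} → s ∧ t ≡ false → t ≡ true → s ≡ false
    first-false {false} _ _ = refl
    first-false {true} refl ()

  good-assignment : Σ (Vec (Fin b) n₁) Good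
  good-assignment = ∃-avoiding-all local-lemma-condition events!

  solution : Σ (Fin n₁ → Fin a) (λ φ →
    Injective _≡_ _≡_ φ × (∀ u → φ u ∈ f u) × (∀ v → 𝓕 v (image φ (N₂ D v)) ≡ false))
  solution = from-good good-assignment
    where
    from-good : Σ (Vec (Fin b) n₁) Good → Σ (Fin n₁ → Fin a) (λ φ →
      Injective _≡_ _≡_ φ × (∀ u → φ u ∈ f u) × (∀ v → 𝓕 v (image φ (N₂ D v)) ≡ false))
    from-good (ω , good) =
      assign ω , good⇒injective good , (λ u → lookup⇒[]= (assign ω u) (f u) (e∈f u (lookup ω u))) , good⇒unspoiled good

levelCount≡0⇒∉ : ∀ {a} (𝓕 : Family a) {k} → levelCount 𝓕 k ≡ 0 → ∀ S → ∣ S ∣ ≡ k → 𝓕 S ≡ false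
levelCount≡0⇒∉ {a} 𝓕 {k} empty S ∣S∣≡k with 𝓕 S in 𝓕S
... | false = refl
... | true = contradiction empty (>⇒≢ (nonempty S∈level))
  where
  S∈level : S ∈ˡ filterᵇ (λ s → (∣ s ∣ ≡ᵇ k) ∧ 𝓕 s) (allSubsets a)
  S∈level = ∈-filter⁺ (T? ∘ (λ s → (∣ s ∣ ≡ᵇ k) ∧ 𝓕 s)) (allSubsets-complete a S)
              (Equivalence.from T-∧ (≡⇒≡ᵇ ∣ S ∣ k ∣S∣≡k , subst T (sym 𝓕S) _))
  nonempty : ∀ {xs} {x : Subset a} → x ∈ˡ xs → 0 < length xs
  nonempty (here _) = s≤s z≤n
  nonempty (there _) = s≤s z≤n

densityBound-level0 : ∀ {a} Δ⁺ Δ⁻ b (𝓕 : Family a) → 1 ≤ Δ⁺ → 1 ≤ Δ⁻ →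
  DensityBound Δ⁺ Δ⁻ b 0 𝓕 → levelCount 𝓕 0 ≡ 0
densityBound-level0 Δ⁺ Δ⁻ b 𝓕 1≤Δ⁺ 1≤Δ⁻ dense = c*16≤1⇒c≡0 (begin
  c * 16                                  ≤⟨ *-mono-≤ (c≤c*c c) 16≤16d² ⟩
  c * c * (16 * ((Δ⁺ * Δ⁻) * (Δ⁺ * Δ⁻)))  ≡⟨ trans (*-identityʳ _) (*-identityʳ _) ⟨
  c * c * (16 * ((Δ⁺ * Δ⁻) * (Δ⁺ * Δ⁻))) * 1 * 1 ≤⟨ dense ⟩
  1                                       ∎)
  where
  open ≤-Reasoning
  c : ℕ
  c = levelCount 𝓕 0
  c≤c*c : ∀ c → c ≤ c * c
  c≤c*c zero = z≤n
  c≤c*c (suc c) = m≤m*n (suc c) (suc c)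
  16≤16d² : 16 ≤ 16 * ((Δ⁺ * Δ⁻) * (Δ⁺ * Δ⁻))
  16≤16d² = *-monoʳ-≤ 16 (*-mono-≤ (*-mono-≤ 1≤Δ⁺ 1≤Δ⁻) (*-mono-≤ 1≤Δ⁺ 1≤Δ⁻))
  c*16≤1⇒c≡0 : ∀ {c} → c * 16 ≤ 1 → c ≡ 0
  c*16≤1⇒c≡0 {zero} _ = refl
  c*16≤1⇒c≡0 {suc c} (s≤s ())

-- With W₁ empty, a and b may vanish and the construction does not apply; only level 0 of the density
-- bound is needed.
without-W₁ : ∀ {n₂} (D : BipGraph 0 n₂) {Δ⁺ Δ⁻} → 1 ≤ Δ⁺ → 1 ≤ Δ⁻ →
  ∀ {a b} (𝓕 : Fin n₂ → Family a) →
  (∀ v → DensityBound Δ⁺ Δ⁻ b ∣ N₂ D v ∣ (𝓕 v)) → (f : Fin 0 → Subset a) →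
  Σ (Fin 0 → Fin a) (λ φ →
    Injective _≡_ _≡_ φ × (∀ u → φ u ∈ f u) × (∀ v → 𝓕 v (image φ (N₂ D v)) ≡ false))
without-W₁ D {Δ⁺} {Δ⁻} 1≤Δ⁺ 1≤Δ⁻ {a} {b} 𝓕 dense f = φ , (λ { {()} }) , (λ ()) , nothing-spoiled
  where
  φ : Fin 0 → Fin a
  φ ()
  nothing-spoiled : ∀ v → 𝓕 v (image φ (N₂ D v)) ≡ false
  nothing-spoiled v = levelCount≡0⇒∉ (𝓕 v) (densityBound-level0 Δ⁺ Δ⁻ b (𝓕 v) 1≤Δ⁺ 1≤Δ⁻ (dense v))
                        (image φ (N₂ D v)) (∣image∣≡∣N∣ (N₂ D v) {φ} (λ ()))

lemma2p14 : (n₁ n₂ : ℕ) (D : BipGraph n₁ n₂) (Δ⁺ Δ⁻ : ℕ) → 1 ≤ Δ⁺ → 1 ≤ Δ⁻ →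
  (∀ u → ∣ N₁ D u ∣ ≤ Δ⁺) → (∀ v → ∣ N₂ D v ∣ ≤ Δ⁻) →
  (a b : ℕ) → b ≤ a → 32 * n₁ ≤ b →
  (𝓕 : Fin n₂ → Family a) →
  (∀ v → DensityBound Δ⁺ Δ⁻ b ∣ N₂ D v ∣ (𝓕 v)) →
  (f : Fin n₁ → Subset a) → (∀ u → b ≤ ∣ f u ∣) →
  Σ (Fin n₁ → Fin a) (λ φ →
    Injective _≡_ _≡_ φ × (∀ u → φ u ∈ f u) × (∀ v → 𝓕 v (image φ (N₂ D v)) ≡ false))
lemma2p14 zero n₂ D Δ⁺ Δ⁻ 1≤Δ⁺ 1≤Δ⁻ _ _ a b _ _ 𝓕 dense f _ =
  without-W₁ D 1≤Δ⁺ 1≤Δ⁻ {b = b} 𝓕 dense f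
lemma2p14 (suc n) n₂ D Δ⁺ Δ⁻ 1≤Δ⁺ 1≤Δ⁻ deg⁺ deg⁻ a b b≤a 32n₁≤b 𝓕 dense f large =
  Construction.solution D 1≤Δ⁺ 1≤Δ⁻ deg⁺ deg⁻ 8<b 32n₁≤b b≤a 𝓕 dense f large
  where
  8<b : 8 < b
  8<b = ≤-trans (m≤m*n 9 (suc n)) (≤-trans (*-monoˡ-≤ (suc n) (m≤m+n 9 23)) 32n₁≤b)
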